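{- In the setting described in the context, $B(S)^t\cdot\bar B(S)=I_rN^{\mathfrak m}$ in $M_r(\mathbb C_\infty)[N]$, where $B(S)^t=\sum_i C_i^tN^i$.
   Context: Let $\mathbb C_\infty$ be the completion of an algebraic closure of $\mathbb F_q((1/\theta))$. Let $V$ be a finite-dimensional $\mathbb C_\infty$-vector space, $N$ a nilpotent operator on $V$, $\mathfrak m\ge1$ with $N^{\mathfrak m}=0$. Let $k_1,\dots,k_{\mathfrak m+1}\ge0$ be integers with sum $r$, and $l_{u,i}\in V$ ($1\le u\le\mathfrak m+1$, $1\le i\le k_u$) such that for every $u_0\in\{0,\dots,\mathfrak m-1\}$ the elements $N^\alpha l_{\beta,\gamma}$, $\alpha\in\{u_0,\dots,\mathfrak m-1\}$, $\beta\in\{\alpha+2,\dots,\mathfrak m+1\}$, $\gamma\in\{1,\dots,k_\beta\}$, form a $\mathbb C_\infty$-basis of $N^{u_0}V$. With $\hat l_u=(l_{u,1},\dots,l_{u,k_u})^t$: for $u\in\{1,\dots,\mathfrak m\}$, $z\in\{u-1,\dots,\mathfrak m-1\}$, $y\in\{z+2,\dots,\mathfrak m+1\}$, $S_{u,u-1,y,z}$ are the unique $k_u\times k_y$ matrices with $N^{u-1}\hat l_u=-\sum_{z=u-1}^{\mathfrak m-1}\sum_{y=z+2}^{\mathfrak m+1}S_{u,u-1,y,z}N^z\hat l_y$; for $v\in\{0,\dots,\mathfrak m-1\}$, $u\in\{1,\dots,\mathfrak m+1\}$, $z\in\{v,\dots,\mathfrak m-1\}$, $y\in\{z+2,\dots,\mathfrak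 m+1\}$, $P_{u,v,y,z}$ are the unique $k_u\times k_y$ matrices with $N^v\hat l_u=-\sum_{z=v}^{\mathfrak m-1}\sum_{y=z+2}^{\mathfrak m+1}P_{u,v,y,z}N^z\hat l_y$. A skew $k$-block matrix is an $r\times r$ matrix divided into $(\mathfrak m+1)\times(\mathfrak m+1)$ blocks, the $(\alpha,\beta)$-block having size $k_\alpha\times k_{\mathfrak m+2-\beta}$. For $i=0,\dots,\mathfrak m$ define skew $k$-block matrices $C_i$: the $(\alpha,\beta)$-block is $S^t_{\mathfrak m+2-\beta,\mathfrak m+1-\beta,\alpha,i}$ whenever this $S$ is defined (i.e. $\mathfrak m+2-\beta\le\mathfrak m$, $\mathfrak m+1-\beta\le i\le\mathfrak m-1$, $\alpha\ge i+2$); the $(i+1,\mathfrak m+1-i)$-block is $I_{k_{i+1}}$; all other blocks are $0$. Define $\bar C_i$: the $(\alpha,\beta)$-block is $-P_{\alpha,\mathfrak m-1-i,\mathfrak m+2-\beta,\mathfrak m-\beta}$ whenever $i\le\mathfrak m-1$, $\alpha\le\mathfrak m-i$, $\beta\le i+1$; the $(\mathfrak m+1-i,i+1)$-block is $I_{k_{\mathfrak m+1-i}}$; all other blocks are $0$. Put $B(S)=\sum_{i=0}^{\mathfrak m}C_iN^i$ and $\bar B(S)=\sum_{i=0}^{\mathfrak m}\bar C_iN^i$, elements of $M_r(\mathbb C_\infty)[N]$ with $N$ a formal variable. -}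

module Defs where

open import Level using (Level; _⊔_) renaming (suc to lsuc)
open import Algebra.Bundles using (CommutativeRing)
open import Data.Nat using (ℕ; zero; suc; _+_; _∸_; _≤_; _<_; _≤?_; _≟_)
open import Data.Fin using (Fin; toℕ)
import Data.Fin as Fin
open import Data.Product using (Σ; _,_; _×_)
open import Data.Product.Properties using (≡-dec)
open import Data.Bool using (Bool; if_then_else_; _∧_)
open import Relation.Nullary using (¬_)
open import Relation.Nullary.Decidable using (⌊_⌋)
open import Function using (_∘_)

-- A field: a commutative ring with 0 ≠ 1 in which every nonzero element
-- has a multiplicative inverse.  (The paper works over ℂ∞; the statement
-- is purely linear-algebraic.)

record Field (c ℓ : Level) : Set (lsuc (c ⊔ ℓ)) where
  field
    commutativeRing : CommutativeRing c ℓ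
  open CommutativeRing commutativeRing public
  field
    0≉1 : ¬ (0# ≈ 1#)
    inverse : ∀ x → ¬ (x ≈ 0#) → Σ Carrier (λ y → (x * y) ≈ 1#)

module LinAlg {c ℓ} (F : Field c ℓ) where
  open Field F renaming (_+_ to _+ᴷ_; _*_ to _*ᴷ_)

  ∑ : (n : ℕ) → (Fin n → Carrier) → Carrier
  ∑ zero    f = 0#
  ∑ (suc n) f = f Fin.zero +ᴷ ∑ n (f ∘ Fin.suc)

  -- ∑[ lo ⋯ hi ] f = Σ_{lo ≤ t ≤ hi} f t   (empty if hi < lo)
  ∑[_⋯_] : ℕ → ℕ → (ℕ → Carrier) → Carrier
  ∑[ lo ⋯ hi ] f = ∑ (suc hi ∸ lo) (λ t → f (lo + toℕ t))

  Vector : ℕ → Set c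
  Vector d = Fin d → Carrier

  Mat : ℕ → ℕ → Set c
  Mat a b = Fin a → Fin b → Carrier

  _·_ : ∀ {d} → Mat d d → Vector d → Vector d
  (N · v) e = ∑ _ (λ j → N e j *ᴷ v j)

  _^_·_ : ∀ {d} → Mat d d → ℕ → Vector d → Vector d
  N ^ zero  · v = v
  N ^ suc n · v = N · (N ^ n · v)

  NilpotentOfOrder : ∀ {d} → Mat d d → ℕ → Set (c ⊔ ℓ)
  NilpotentOfOrder N m = ∀ v e → (N ^ m · v) e ≈ 0#

-- The setting of the lemma.  Block indices α, β, u, v, y, z are natural
-- numbers as in the paper (blocks numbered 1 … m+1); l u i is l_{u,i+1}
-- (the index i ranges over Fin (k u)).

module Setting {c ℓ} (F : Field c ℓ) {d : ℕ} (N : LinAlg.Mat F d d)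
               (m : ℕ) (k : ℕ → ℕ)
               (l : (u : ℕ) → Fin (k u) → LinAlg.Vector F d) where
  open Field F renaming (_+_ to _+ᴷ_; _*_ to _*ᴷ_)
  open LinAlg F

  Coeffs : Set c
  Coeffs = (α β : ℕ) → Fin (k β) → Carrier

  combo : ℕ → Coeffs → Vector d
  combo u0 cf e =
    ∑[ u0 ⋯ m ∸ 1 ] (λ α → ∑[ α + 2 ⋯ suc m ] (λ β →
      ∑ (k β) (λ γ → cf α β γ *ᴷ (N ^ α · l β γ) e)))

  Spans : ℕ → Set (c ⊔ ℓ)
  Spans u0 = ∀ v → Σ Coeffs (λ cf → ∀ e → (N ^ u0 · v) e ≈ combo u0 cf e)

  Independent : ℕ → Set (c ⊔ ℓ)
  Independent u0 = ∀ cf → (∀ e → combo u0 cf e ≈ 0#) →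
    ∀ α β γ → u0 ≤ α → α ≤ m ∸ 1 → α + 2 ≤ β → β ≤ suc m → cf α β γ ≈ 0#

  -- for every u0 ∈ {0,…,m-1}, the family is a basis of N^{u0} V
  -- (its members lie in N^{u0} V automatically since α ≥ u0)
  BasisHyp : Set (c ⊔ ℓ)
  BasisHyp = ∀ u0 → u0 < m → Spans u0 × Independent u0

  Fam : Set c
  Fam = (u v y z : ℕ) → Fin (k u) → Fin (k y) → Carrier

  rhs : Fam → (u v : ℕ) → Fin (k u) → Fin d → Carrier
  rhs M u v i e =
    ∑[ v ⋯ m ∸ 1 ] (λ z → ∑[ z + 2 ⋯ suc m ] (λ y →
      ∑ (k y) (λ j → M u v y z i j *ᴷ (N ^ z · l y j) e)))

  SEq : Fam → Set ℓ
  SEq S = ∀ u → 1 ≤ u → u ≤ m → ∀ (i : Fin (k u)) e →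
    (N ^ (u ∸ 1) · l u i) e ≈ - rhs S u (u ∸ 1) i e

  PEq : Fam → Set ℓ
  PEq P = ∀ u v → 1 ≤ u → u ≤ suc m → v < m → ∀ (i : Fin (k u)) e →
    (N ^ v · l u i) e ≈ - rhs P u v i e

  -- The r = k_1+…+k_{m+1} rows are indexed by
  -- pairs (a , p): block α = a+1, p < k_α; the r columns by pairs (b , q):
  -- block β = b+1, q < k_{m+2-β}.  (Ordering the pairs lexicographically
  -- gives the usual r×r matrix.)

  RowIdx : Set
  RowIdx = Σ (Fin (suc m)) (λ a → Fin (k (suc (toℕ a))))

  ColIdx : Set
  ColIdx = Σ (Fin (suc m)) (λ b → Fin (k (suc m ∸ toℕ b)))

  SkewMat : Set c
  SkewMat = RowIdx → ColIdx → Carrier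

  -- C_i (i ∈ ℕ; C_i = 0 for i > m)
  C : Fam → ℕ → SkewMat
  C S i (a , p) (b , q) =
    if ⌊ i ≤? m ⌋ ∧ ⌊ toℕ a ≟ i ⌋ ∧ ⌊ toℕ b ≟ m ∸ i ⌋
      -- (i+1, m+1-i)-block : identity
      then (if ⌊ toℕ p ≟ toℕ q ⌋ then 1# else 0#)
    else if ⌊ 2 ≤? β ⌋ ∧ ⌊ (m + 1) ∸ β ≤? i ⌋ ∧ ⌊ suc i ≤? m ⌋ ∧ ⌊ i + 2 ≤? α ⌋
      -- (α,β)-block : S^t_{m+2-β, m+1-β, α, i}
      then S (suc m ∸ toℕ b) (m ∸ toℕ b) α i q p
    else 0#
    where α = suc (toℕ a)
          β = suc (toℕ b)

  -- C̄_i (i ∈ ℕ; C̄_i = 0 for i > m)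
  C̄ : Fam → ℕ → SkewMat
  C̄ P i (a , p) (b , q) =
    if ⌊ i ≤? m ⌋ ∧ ⌊ toℕ a ≟ m ∸ i ⌋ ∧ ⌊ toℕ b ≟ i ⌋
      -- (m+1-i, i+1)-block : identity
      then (if ⌊ toℕ p ≟ toℕ q ⌋ then 1# else 0#)
    else if ⌊ suc i ≤? m ⌋ ∧ ⌊ α ≤? m ∸ i ⌋ ∧ ⌊ β ≤? suc i ⌋
      -- (α,β)-block : - P_{α, m-1-i, m+2-β, m-β}
      then - P α (m ∸ suc i) (suc m ∸ toℕ b) (m ∸ β) p q
    else 0#
    where α = suc (toℕ a)
          β = suc (toℕ b)

  _ᵗ⊙_ : SkewMat → SkewMat → ColIdx → ColIdx → Carrier
  (X ᵗ⊙ Y) x y =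
    ∑ (suc m) (λ a → ∑ (k (suc (toℕ a))) (λ p → X (a , p) x *ᴷ Y (a , p) y))

  -- coefficient of N^n in B(S)^t · B̄(S) = (Σ_i C_i^t N^i)(Σ_j C̄_j N^j)
  productCoeff : Fam → Fam → ℕ → ColIdx → ColIdx → Carrier
  productCoeff S P n x y = ∑[ 0 ⋯ n ] (λ i → (C S i ᵗ⊙ C̄ P (n ∸ i)) x y)

  I : ColIdx → ColIdx → Carrier
  I x y = if ⌊ ≡-dec Fin._≟_ Fin._≟_ x y ⌋ then 1# else 0#

  targetCoeff : ℕ → ColIdx → ColIdx → Carrier
  targetCoeff n x y = if ⌊ n ≟ m ⌋ then I x y else 0#

  ProductIdentity : Fam → Fam → Set ℓ
  ProductIdentity S P = ∀ n x y → productCoeff S P n x y ≈ targetCoeff n x y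

{-# OPTIONS --safe #-}
-- Read B(S) = Σᵢ Cᵢ Nⁱ column by column. Applied to the family Nⁱ l_{α,p}, every column of B(S)
-- gives zero: this is the defining equation of S (and Nᵐ = 0 for the last column). Dually, for
-- j < m the first m columns of C̄ⱼ are, by the defining equation of P, the coordinates of
-- N^{m-1-j} l_{α,p} along the basis vectors N^{m-1-B} l_{m+1-B}. So for n < m the coefficient of
-- Nⁿ in B(S)ᵗ B̄(S) is such a coordinate of N^{m-1-n} applied to a column relation, hence zero.
-- For n ≥ m only supports matter: Cᵢ lives in the rows α > i and C̄ⱼ in the rows α ≤ m + 1 - j,
-- which leaves nothing for n > m and just the identity blocks for n = m.
module Submission where

open import Defs
open import Data.Nat using (ℕ; zero; suc; _+_; _∸_; _≤_; _<_; _≤?_; _<?_; _≟_; pred; z≤n; s≤s)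
import Data.Nat.Properties as ℕₚ
open import Data.Fin using (Fin; toℕ)
import Data.Fin as Fin
import Data.Fin.Properties as Finₚ
open import Data.Product using (_,_; _×_; proj₁; proj₂)
open import Data.Product.Properties using (≡-dec)
open import Data.Sum using (_⊎_; inj₁; inj₂; [_,_])
open import Data.Bool using (true; false; if_then_else_; _∧_)
open import Data.Bool.Properties using (if-cong)
open import Level using (Level)
open import Data.Empty using (⊥; ⊥-elim)
open import Function using (_∘_; case_of_)
open import Relation.Nullary using (¬_; Dec; yes; no; _×-dec_)
open import Relation.Nullary.Decidable using (⌊_⌋)
open import Relation.Binary.Definitions using (Tri; tri<; tri≈; tri>)
import Relation.Binary.PropositionalEquality as ≡
open ≡ using (_≡_; _≢_; cong; subst)

private
  variable
    a : Level
    X : Set a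
    A₁ A₂ A₃ A₄ : Set

⌊⌋-∧ : (a? : Dec A₁) (b? : Dec A₂) → (⌊ a? ⌋ ∧ ⌊ b? ⌋) ≡ ⌊ a? ×-dec b? ⌋
⌊⌋-∧ (yes _) (yes _) = ≡.refl
⌊⌋-∧ (yes _) (no _)  = ≡.refl
⌊⌋-∧ (no _)  _       = ≡.refl

⌊⌋-∧₃ : (a? : Dec A₁) (b? : Dec A₂) (c? : Dec A₃) →
        (⌊ a? ⌋ ∧ ⌊ b? ⌋ ∧ ⌊ c? ⌋) ≡ ⌊ a? ×-dec b? ×-dec c? ⌋
⌊⌋-∧₃ a? b? c? = ≡.trans (cong (⌊ a? ⌋ ∧_) (⌊⌋-∧ b? c?)) (⌊⌋-∧ a? (b? ×-dec c?))

⌊⌋-∧₄ : (a? : Dec A₁) (b? : Dec A₂) (c? : Dec A₃) (d? : Dec A₄) →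
        (⌊ a? ⌋ ∧ ⌊ b? ⌋ ∧ ⌊ c? ⌋ ∧ ⌊ d? ⌋) ≡ ⌊ a? ×-dec b? ×-dec c? ×-dec d? ⌋
⌊⌋-∧₄ a? b? c? d? = ≡.trans (cong (⌊ a? ⌋ ∧_) (⌊⌋-∧₃ b? c? d?)) (⌊⌋-∧ a? (b? ×-dec c? ×-dec d?))

⌊⌋≡true⇒ : (a? : Dec A₁) → ⌊ a? ⌋ ≡ true → A₁
⌊⌋≡true⇒ (yes a) _ = a

⌊⌋≡false : (a? : Dec A₁) → ¬ A₁ → ⌊ a? ⌋ ≡ false
⌊⌋≡false (yes a) ¬a = ⊥-elim (¬a a)
⌊⌋≡false (no _)  _  = ≡.refl

if-yes : (a? : Dec A₁) {x y : X} → A₁ → (if ⌊ a? ⌋ then x else y) ≡ x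
if-yes (yes _) _ = ≡.refl
if-yes (no ¬a) a = ⊥-elim (¬a a)

if-no : (a? : Dec A₁) {x y : X} → ¬ A₁ → (if ⌊ a? ⌋ then x else y) ≡ y
if-no (yes a) ¬a = ⊥-elim (¬a a)
if-no (no _)  _  = ≡.refl

if-yes₂ : (a? : Dec A₁) (b? : Dec A₂) {x y : X} → A₁ × A₂ → (if ⌊ a? ⌋ ∧ ⌊ b? ⌋ then x else y) ≡ x
if-yes₂ a? b? ab = ≡.trans (if-cong (⌊⌋-∧ a? b?)) (if-yes (a? ×-dec b?) ab)

if-no₂ : (a? : Dec A₁) (b? : Dec A₂) {x y : X} → ¬ (A₁ × A₂) → (if ⌊ a? ⌋ ∧ ⌊ b? ⌋ then x else y) ≡ y
if-no₂ a? b? ¬ab = ≡.trans (if-cong (⌊⌋-∧ a? b?)) (if-no (a? ×-dec b?) ¬ab)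

if-yes₃ : (a? : Dec A₁) (b? : Dec A₂) (c? : Dec A₃) {x y : X} → A₁ × A₂ × A₃ →
          (if ⌊ a? ⌋ ∧ ⌊ b? ⌋ ∧ ⌊ c? ⌋ then x else y) ≡ x
if-yes₃ a? b? c? abc = ≡.trans (if-cong (⌊⌋-∧₃ a? b? c?)) (if-yes (a? ×-dec b? ×-dec c?) abc)

if-no₃ : (a? : Dec A₁) (b? : Dec A₂) (c? : Dec A₃) {x y : X} → ¬ (A₁ × A₂ × A₃) →
         (if ⌊ a? ⌋ ∧ ⌊ b? ⌋ ∧ ⌊ c? ⌋ then x else y) ≡ y
if-no₃ a? b? c? ¬abc = ≡.trans (if-cong (⌊⌋-∧₃ a? b? c?)) (if-no (a? ×-dec b? ×-dec c?) ¬abc)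

if-yes₄ : (a? : Dec A₁) (b? : Dec A₂) (c? : Dec A₃) (d? : Dec A₄) {x y : X} → A₁ × A₂ × A₃ × A₄ →
          (if ⌊ a? ⌋ ∧ ⌊ b? ⌋ ∧ ⌊ c? ⌋ ∧ ⌊ d? ⌋ then x else y) ≡ x
if-yes₄ a? b? c? d? abcd =
  ≡.trans (if-cong (⌊⌋-∧₄ a? b? c? d?)) (if-yes (a? ×-dec b? ×-dec c? ×-dec d?) abcd)

if-no₄ : (a? : Dec A₁) (b? : Dec A₂) (c? : Dec A₃) (d? : Dec A₄) {x y : X} → ¬ (A₁ × A₂ × A₃ × A₄) →
         (if ⌊ a? ⌋ ∧ ⌊ b? ⌋ ∧ ⌊ c? ⌋ ∧ ⌊ d? ⌋ then x else y) ≡ y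
if-no₄ a? b? c? d? ¬abcd =
  ≡.trans (if-cong (⌊⌋-∧₄ a? b? c? d?)) (if-no (a? ×-dec b? ×-dec c? ×-dec d?) ¬abcd)

module FieldSums {c ℓ} (F : Field c ℓ) where
  open Field F renaming (_+_ to _+ᴷ_; _*_ to _*ᴷ_)
  open LinAlg F using (∑; ∑[_⋯_])
  open import Algebra.Properties.Ring ring using (-1*x≈-x)
  open import Algebra.Properties.CommutativeSemigroup +-commutativeSemigroup using (interchange)
  open import Relation.Binary.Reasoning.Setoid setoid

  ∑-cong : ∀ n {f g : Fin n → Carrier} → (∀ i → f i ≈ g i) → ∑ n f ≈ ∑ n g
  ∑-cong zero    f≈g = refl
  ∑-cong (suc n) f≈g = +-cong (f≈g Fin.zero) (∑-cong n (f≈g ∘ Fin.suc))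

  ∑-zero : ∀ n {f : Fin n → Carrier} → (∀ i → f i ≈ 0#) → ∑ n f ≈ 0#
  ∑-zero zero    f≈0 = refl
  ∑-zero (suc n) f≈0 =
    trans (+-cong (f≈0 Fin.zero) (∑-zero n (f≈0 ∘ Fin.suc))) (+-identityˡ 0#)

  ∑-distrib-+ : ∀ n (f g : Fin n → Carrier) →
                ∑ n (λ i → f i +ᴷ g i) ≈ ∑ n f +ᴷ ∑ n g
  ∑-distrib-+ zero    f g = sym (+-identityˡ 0#)
  ∑-distrib-+ (suc n) f g =
    trans (+-congˡ (∑-distrib-+ n (f ∘ Fin.suc) (g ∘ Fin.suc))) (interchange _ _ _ _)

  *-distribˡ-∑ : ∀ n a (f : Fin n → Carrier) → a *ᴷ ∑ n f ≈ ∑ n (λ i → a *ᴷ f i)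
  *-distribˡ-∑ zero    a f = zeroʳ a
  *-distribˡ-∑ (suc n) a f =
    trans (distribˡ a _ _) (+-congˡ (*-distribˡ-∑ n a (f ∘ Fin.suc)))

  ∑-single : ∀ n (f : Fin n → Carrier) (i₀ : Fin n) →
             (∀ i → toℕ i ≢ toℕ i₀ → f i ≈ 0#) → ∑ n f ≈ f i₀
  ∑-single (suc n) f Fin.zero f≈0 =
    trans (+-congˡ (∑-zero n (λ i → f≈0 (Fin.suc i) (λ ())))) (+-identityʳ _)
  ∑-single (suc n) f (Fin.suc i₀) f≈0 =
    trans (+-congʳ (f≈0 Fin.zero (λ ())))
      (trans (+-identityˡ _)
        (∑-single n (f ∘ Fin.suc) i₀ (λ i i≢i₀ → f≈0 (Fin.suc i) (i≢i₀ ∘ ℕₚ.suc-injective))))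

  δ : ℕ → ℕ → Carrier
  δ i j = if ⌊ i ≟ j ⌋ then 1# else 0#

  δ-refl : ∀ i → δ i i ≡ 1#
  δ-refl i = if-yes (i ≟ i) ≡.refl

  δ-≢ : ∀ {i j} → i ≢ j → δ i j ≡ 0#
  δ-≢ {i} {j} i≢j = if-no (i ≟ j) i≢j

  δ-sym : ∀ i j → δ i j ≡ δ j i
  δ-sym i j with i ≟ j
  ... | yes ≡.refl = ≡.sym (δ-refl i)
  ... | no i≢j = ≡.sym (δ-≢ (i≢j ∘ ≡.sym))

  if-else-split : ∀ b₁ b₂ {x y : Carrier} → (b₁ ≡ true → b₂ ≡ false) →
                  (if b₁ then x else (if b₂ then y else 0#)) ≈
                  (if b₁ then x else 0#) +ᴷ (if b₂ then y else 0#)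
  if-else-split true  b₂ exclusive rewrite exclusive ≡.refl = sym (+-identityʳ _)
  if-else-split false b₂ _ = sym (+-identityˡ _)

  private
    ∑from : ℕ → ℕ → (ℕ → Carrier) → Carrier
    ∑from lo zero    f = 0#
    ∑from lo (suc n) f = f lo +ᴷ ∑from (suc lo) n f

    ∑-shifted≈∑from : ∀ n lo (f : ℕ → Carrier) → ∑ n (λ t → f (lo + toℕ t)) ≈ ∑from lo n f
    ∑-shifted≈∑from zero    lo f = refl
    ∑-shifted≈∑from (suc n) lo f =
      +-cong (reflexive (cong f (ℕₚ.+-identityʳ lo)))
        (trans (∑-cong n (λ t → reflexive (cong f (ℕₚ.+-suc lo (toℕ t)))))
               (∑-shifted≈∑from n (suc lo) f))

    ∑[⋯]≈∑from : ∀ lo hi (f : ℕ → Carrier) → ∑[ lo ⋯ hi ] f ≈ ∑from lo (suc hi ∸ lo) f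
    ∑[⋯]≈∑from lo hi = ∑-shifted≈∑from (suc hi ∸ lo) lo

    InRange : ℕ → ℕ → ℕ → Set
    InRange lo n t = lo ≤ t × t < lo + n

    inRange-tail : ∀ {lo n t} → InRange (suc lo) n t → InRange lo (suc n) t
    inRange-tail {lo} {n} (lo<t , t<) =
      ℕₚ.<⇒≤ lo<t , ℕₚ.≤-trans t< (ℕₚ.≤-reflexive (≡.sym (ℕₚ.+-suc lo n)))

    inRange-head : ∀ lo n → InRange lo (suc n) lo
    inRange-head lo n = ℕₚ.≤-refl , ℕₚ.m<m+n lo (s≤s z≤n)

    ∑from-zero : ∀ n lo {f : ℕ → Carrier} → (∀ t → InRange lo n t → f t ≈ 0#) → ∑from lo n f ≈ 0#
    ∑from-zero zero    lo f≈0 = refl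
    ∑from-zero (suc n) lo f≈0 =
      trans (+-cong (f≈0 lo (inRange-head lo n)) (∑from-zero n (suc lo) (λ t → f≈0 t ∘ inRange-tail)))
            (+-identityˡ 0#)

    ∑from-++ : ∀ a b lo (f : ℕ → Carrier) → ∑from lo (a + b) f ≈ ∑from lo a f +ᴷ ∑from (lo + a) b f
    ∑from-++ zero    b lo f =
      trans (reflexive (cong (λ lo′ → ∑from lo′ b f) (≡.sym (ℕₚ.+-identityʳ lo))))
            (sym (+-identityˡ _))
    ∑from-++ (suc a) b lo f =
      trans (+-congˡ (trans (∑from-++ a b (suc lo) f)
                            (+-congˡ (reflexive (cong (λ lo′ → ∑from lo′ b f) (≡.sym (ℕₚ.+-suc lo a)))))))
            (sym (+-assoc _ _ _))

    ∑from-single : ∀ n lo (f : ℕ → Carrier) t₀ → InRange lo n t₀ →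
                   (∀ t → InRange lo n t → t ≢ t₀ → f t ≈ 0#) → ∑from lo n f ≈ f t₀
    ∑from-single zero lo f t₀ (lo≤t₀ , t₀<) f≈0 =
      ⊥-elim (ℕₚ.<-irrefl ≡.refl (ℕₚ.≤-trans t₀< (ℕₚ.≤-trans (ℕₚ.≤-reflexive (ℕₚ.+-identityʳ lo)) lo≤t₀)))
    ∑from-single (suc n) lo f t₀ t₀∈ f≈0 with lo ≟ t₀
    ... | yes ≡.refl =
      trans (+-congˡ (∑from-zero n (suc lo) (λ t t∈ → f≈0 t (inRange-tail t∈) (ℕₚ.<⇒≢ (proj₁ t∈) ∘ ≡.sym))))
            (+-identityʳ _)
    ... | no lo≢t₀ =
      trans (+-congʳ (f≈0 lo (inRange-head lo n) lo≢t₀))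
        (trans (+-identityˡ _)
          (∑from-single n (suc lo) f t₀
            (ℕₚ.≤∧≢⇒< (proj₁ t₀∈) lo≢t₀ , ℕₚ.≤-trans (proj₂ t₀∈) (ℕₚ.≤-reflexive (ℕₚ.+-suc lo n)))
            (λ t → f≈0 t ∘ inRange-tail)))

    ∑from-split : ∀ lo mid hi (f : ℕ → Carrier) → lo ≤ mid → mid ≤ suc hi →
                  ∑[ lo ⋯ hi ] f ≈ ∑from lo (mid ∸ lo) f +ᴷ ∑[ mid ⋯ hi ] f
    ∑from-split lo mid hi f lo≤mid mid≤1+hi = begin
      ∑[ lo ⋯ hi ] f                                  ≈⟨ ∑[⋯]≈∑from lo hi f ⟩
      ∑from lo (suc hi ∸ lo) f                        ≡⟨ cong (λ n → ∑from lo n f) lengths ⟨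
      ∑from lo ((mid ∸ lo) + (suc hi ∸ mid)) f        ≈⟨ ∑from-++ (mid ∸ lo) (suc hi ∸ mid) lo f ⟩
      ∑from lo (mid ∸ lo) f +ᴷ ∑from (lo + (mid ∸ lo)) (suc hi ∸ mid) f
        ≡⟨ cong (λ lo′ → ∑from lo (mid ∸ lo) f +ᴷ ∑from lo′ (suc hi ∸ mid) f) lo+[mid∸lo]≡mid ⟩
      ∑from lo (mid ∸ lo) f +ᴷ ∑from mid (suc hi ∸ mid) f
        ≈⟨ +-congˡ (∑[⋯]≈∑from mid hi f) ⟨
      ∑from lo (mid ∸ lo) f +ᴷ ∑[ mid ⋯ hi ] f        ∎
      where
      lo+[mid∸lo]≡mid : lo + (mid ∸ lo) ≡ mid
      lo+[mid∸lo]≡mid = ℕₚ.m+[n∸m]≡n lo≤mid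
      lengths : (mid ∸ lo) + (suc hi ∸ mid) ≡ suc hi ∸ lo
      lengths = ℕₚ.+-cancelˡ-≡ lo _ _ (≡.trans (≡.sym (ℕₚ.+-assoc lo (mid ∸ lo) _))
                  (≡.trans (cong (_+ (suc hi ∸ mid)) lo+[mid∸lo]≡mid)
                    (≡.trans (ℕₚ.m+[n∸m]≡n mid≤1+hi)
                      (≡.sym (ℕₚ.m+[n∸m]≡n (ℕₚ.≤-trans lo≤mid mid≤1+hi))))))

  infix 4 _∈[_⋯_]
  _∈[_⋯_] : ℕ → ℕ → ℕ → Set
  t ∈[ lo ⋯ hi ] = lo ≤ t × t ≤ hi

  private
    ∈⇒InRange : ∀ {lo hi t} → t ∈[ lo ⋯ hi ] → InRange lo (suc hi ∸ lo) t
    ∈⇒InRange {lo} {hi} (lo≤t , t≤hi) =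
      lo≤t , ℕₚ.≤-trans (s≤s t≤hi)
               (ℕₚ.≤-reflexive (≡.sym (ℕₚ.m+[n∸m]≡n (ℕₚ.≤-trans lo≤t (ℕₚ.≤-trans t≤hi (ℕₚ.n≤1+n hi))))))

    InRange⇒∈ : ∀ {lo hi t} → InRange lo (suc hi ∸ lo) t → t ∈[ lo ⋯ hi ]
    InRange⇒∈ {lo} {hi} {t} (lo≤t , t<) with lo ≤? suc hi
    ... | yes lo≤1+hi = lo≤t , ℕₚ.≤-pred (ℕₚ.≤-trans t< (ℕₚ.≤-reflexive (ℕₚ.m+[n∸m]≡n lo≤1+hi)))
    ... | no lo≰1+hi = ⊥-elim (ℕₚ.<⇒≱ t<lo lo≤t)
      where
      t<lo : t < lo
      t<lo = subst (t <_) (≡.trans (cong (lo +_) (ℕₚ.m≤n⇒m∸n≡0 (ℕₚ.<⇒≤ (ℕₚ.≰⇒> lo≰1+hi))))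
                                   (ℕₚ.+-identityʳ lo)) t<

  ∑[⋯]-cong : ∀ lo hi {f g : ℕ → Carrier} →
              (∀ t → t ∈[ lo ⋯ hi ] → f t ≈ g t) → ∑[ lo ⋯ hi ] f ≈ ∑[ lo ⋯ hi ] g
  ∑[⋯]-cong lo hi f≈g = ∑-cong (suc hi ∸ lo) (λ t →
    f≈g (lo + toℕ t) (InRange⇒∈ (ℕₚ.m≤m+n lo (toℕ t) , ℕₚ.+-monoʳ-< lo (Finₚ.toℕ<n t))))

  ∑[⋯]-zero : ∀ lo hi {f : ℕ → Carrier} → (∀ t → t ∈[ lo ⋯ hi ] → f t ≈ 0#) → ∑[ lo ⋯ hi ] f ≈ 0#
  ∑[⋯]-zero lo hi {f} f≈0 = trans (∑[⋯]-cong lo hi {f} {λ _ → 0#} f≈0) (∑-zero (suc hi ∸ lo) (λ _ → refl))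

  ∑[⋯]-distrib-+ : ∀ lo hi (f g : ℕ → Carrier) →
                   ∑[ lo ⋯ hi ] (λ t → f t +ᴷ g t) ≈ ∑[ lo ⋯ hi ] f +ᴷ ∑[ lo ⋯ hi ] g
  ∑[⋯]-distrib-+ lo hi f g = ∑-distrib-+ (suc hi ∸ lo) (λ t → f (lo + toℕ t)) (λ t → g (lo + toℕ t))

  *-distribˡ-∑[⋯] : ∀ lo hi r (f : ℕ → Carrier) → r *ᴷ ∑[ lo ⋯ hi ] f ≈ ∑[ lo ⋯ hi ] (λ t → r *ᴷ f t)
  *-distribˡ-∑[⋯] lo hi r f = *-distribˡ-∑ (suc hi ∸ lo) r (λ t → f (lo + toℕ t))

  ∑[⋯]-single : ∀ lo hi (f : ℕ → Carrier) t₀ → t₀ ∈[ lo ⋯ hi ] →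
                (∀ t → t ∈[ lo ⋯ hi ] → t ≢ t₀ → f t ≈ 0#) → ∑[ lo ⋯ hi ] f ≈ f t₀
  ∑[⋯]-single lo hi f t₀ t₀∈ f≈0 =
    trans (∑[⋯]≈∑from lo hi f) (∑from-single _ lo f t₀ (∈⇒InRange t₀∈) (λ t → f≈0 t ∘ InRange⇒∈))

  ∑[⋯]-dropˡ : ∀ lo mid hi (f : ℕ → Carrier) → lo ≤ mid → mid ≤ suc hi →
               (∀ t → lo ≤ t → t < mid → f t ≈ 0#) → ∑[ lo ⋯ hi ] f ≈ ∑[ mid ⋯ hi ] f
  ∑[⋯]-dropˡ lo mid hi f lo≤mid mid≤1+hi f≈0 =
    trans (∑from-split lo mid hi f lo≤mid mid≤1+hi)
      (trans (+-congʳ (∑from-zero (mid ∸ lo) lo (λ t t∈ → f≈0 t (proj₁ t∈)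
                (ℕₚ.≤-trans (proj₂ t∈) (ℕₚ.≤-reflexive (ℕₚ.m+[n∸m]≡n lo≤mid))))))
             (+-identityˡ _))

  ∑[⋯]-dropʳ : ∀ lo hi hi′ (f : ℕ → Carrier) → lo ≤ suc hi → hi ≤ hi′ →
               (∀ t → hi < t → t ≤ hi′ → f t ≈ 0#) → ∑[ lo ⋯ hi′ ] f ≈ ∑[ lo ⋯ hi ] f
  ∑[⋯]-dropʳ lo hi hi′ f lo≤1+hi hi≤hi′ f≈0 = begin
    ∑[ lo ⋯ hi′ ] f
      ≈⟨ ∑from-split lo (suc hi) hi′ f lo≤1+hi (s≤s hi≤hi′) ⟩
    ∑from lo (suc hi ∸ lo) f +ᴷ ∑[ suc hi ⋯ hi′ ] f
      ≈⟨ +-cong (sym (∑[⋯]≈∑from lo hi f)) (∑[⋯]-zero (suc hi) hi′ (λ t (hi<t , t≤hi′) → f≈0 t hi<t t≤hi′)) ⟩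
    ∑[ lo ⋯ hi ] f +ᴷ 0#
      ≈⟨ +-identityʳ _ ⟩
    ∑[ lo ⋯ hi ] f ∎


  module _ (k : ℕ → ℕ) where

    ∑³ : ℕ → ℕ → (ℕ → ℕ) → (ℕ → ℕ) → ((i α : ℕ) → Fin (k α) → Carrier) → Carrier
    ∑³ lo hi lo′ hi′ f = ∑[ lo ⋯ hi ] (λ i → ∑[ lo′ i ⋯ hi′ i ] (λ α → ∑ (k α) (f i α)))

    module _ (lo hi : ℕ) (lo′ hi′ : ℕ → ℕ) where

      Within : ℕ → ℕ → Set
      Within i α = i ∈[ lo ⋯ hi ] × α ∈[ lo′ i ⋯ hi′ i ]

      ∑³-cong : ∀ {f g : (i α : ℕ) → Fin (k α) → Carrier} →
                (∀ i α p → Within i α → f i α p ≈ g i α p) → ∑³ lo hi lo′ hi′ f ≈ ∑³ lo hi lo′ hi′ g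
      ∑³-cong f≈g = ∑[⋯]-cong lo hi (λ i i∈ →
        ∑[⋯]-cong (lo′ i) (hi′ i) (λ α α∈ → ∑-cong (k α) (λ p → f≈g i α p (i∈ , α∈))))

      ∑³-zero : ∀ (f : (i α : ℕ) → Fin (k α) → Carrier) →
                (∀ i α p → Within i α → f i α p ≈ 0#) → ∑³ lo hi lo′ hi′ f ≈ 0#
      ∑³-zero f f≈0 = ∑[⋯]-zero lo hi (λ i i∈ →
        ∑[⋯]-zero (lo′ i) (hi′ i) (λ α α∈ → ∑-zero (k α) (λ p → f≈0 i α p (i∈ , α∈))))

      ∑³-single : ∀ (f : (i α : ℕ) → Fin (k α) → Carrier) i₀ α₀ (p₀ : Fin (k α₀)) → Within i₀ α₀ →
                  (∀ i α p → Within i α → i ≢ i₀ ⊎ α ≢ α₀ ⊎ toℕ p ≢ toℕ p₀ → f i α p ≈ 0#) →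
                  ∑³ lo hi lo′ hi′ f ≈ f i₀ α₀ p₀
      ∑³-single f i₀ α₀ p₀ (i₀∈ , α₀∈) f≈0 =
        trans (∑[⋯]-single lo hi _ i₀ i₀∈ (λ i i∈ i≢i₀ →
                 ∑[⋯]-zero (lo′ i) (hi′ i) (λ α α∈ →
                   ∑-zero (k α) (λ p → f≈0 i α p (i∈ , α∈) (inj₁ i≢i₀)))))
          (trans (∑[⋯]-single (lo′ i₀) (hi′ i₀) _ α₀ α₀∈ (λ α α∈ α≢α₀ →
                    ∑-zero (k α) (λ p → f≈0 i₀ α p (i₀∈ , α∈) (inj₂ (inj₁ α≢α₀)))))
                 (∑-single (k α₀) (f i₀ α₀) p₀ (λ p p≢p₀ →
                    f≈0 i₀ α₀ p (i₀∈ , α₀∈) (inj₂ (inj₂ p≢p₀)))))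

      ∑³-distrib-+ : ∀ (f g : (i α : ℕ) → Fin (k α) → Carrier) →
                     ∑³ lo hi lo′ hi′ (λ i α p → f i α p +ᴷ g i α p) ≈
                     ∑³ lo hi lo′ hi′ f +ᴷ ∑³ lo hi lo′ hi′ g
      ∑³-distrib-+ f g =
        trans (∑[⋯]-cong lo hi (λ i _ →
                 trans (∑[⋯]-cong (lo′ i) (hi′ i) (λ α _ → ∑-distrib-+ (k α) (f i α) (g i α)))
                       (∑[⋯]-distrib-+ (lo′ i) (hi′ i) (λ α → ∑ (k α) (f i α)) (λ α → ∑ (k α) (g i α)))))
              (∑[⋯]-distrib-+ lo hi (λ i → ∑[ lo′ i ⋯ hi′ i ] (λ α → ∑ (k α) (f i α)))
                                    (λ i → ∑[ lo′ i ⋯ hi′ i ] (λ α → ∑ (k α) (g i α))))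

      *-distribˡ-∑³ : ∀ r (f : (i α : ℕ) → Fin (k α) → Carrier) →
                      r *ᴷ ∑³ lo hi lo′ hi′ f ≈ ∑³ lo hi lo′ hi′ (λ i α p → r *ᴷ f i α p)
      *-distribˡ-∑³ r f =
        trans (*-distribˡ-∑[⋯] lo hi r (λ i → ∑[ lo′ i ⋯ hi′ i ] (λ α → ∑ (k α) (f i α))))
              (∑[⋯]-cong lo hi (λ i _ →
                 trans (*-distribˡ-∑[⋯] (lo′ i) (hi′ i) r (λ α → ∑ (k α) (f i α)))
                       (∑[⋯]-cong (lo′ i) (hi′ i) (λ α _ → *-distribˡ-∑ (k α) r (f i α)))))

      -‿distrib-∑³ : ∀ (f : (i α : ℕ) → Fin (k α) → Carrier) →
                     ∑³ lo hi lo′ hi′ (λ i α p → - f i α p) ≈ - ∑³ lo hi lo′ hi′ f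
      -‿distrib-∑³ f = begin
        ∑³ lo hi lo′ hi′ (λ i α p → - f i α p)          ≈⟨ ∑³-cong (λ i α p _ → sym (-1*x≈-x (f i α p))) ⟩
        ∑³ lo hi lo′ hi′ (λ i α p → - 1# *ᴷ f i α p)    ≈⟨ *-distribˡ-∑³ (- 1#) f ⟨
        - 1# *ᴷ ∑³ lo hi lo′ hi′ f                      ≈⟨ -1*x≈-x _ ⟩
        - ∑³ lo hi lo′ hi′ f                            ∎

  module Linear {a} {A : Set a} (Φ : (A → Carrier) → Carrier)
      (Φ-cong : ∀ {f g} → (∀ x → f x ≈ g x) → Φ f ≈ Φ g)
      (Φ-+ : ∀ f g → Φ (λ x → f x +ᴷ g x) ≈ Φ f +ᴷ Φ g)
      (Φ-* : ∀ r f → Φ (λ x → r *ᴷ f x) ≈ r *ᴷ Φ f) where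

    Φ-0 : Φ (λ _ → 0#) ≈ 0#
    Φ-0 = begin
      Φ (λ _ → 0#)         ≈⟨ Φ-cong (λ _ → sym (zeroˡ 0#)) ⟩
      Φ (λ _ → 0# *ᴷ 0#)   ≈⟨ Φ-* 0# (λ _ → 0#) ⟩
      0# *ᴷ Φ (λ _ → 0#)   ≈⟨ zeroˡ _ ⟩
      0#                   ∎

    Φ-∑ : ∀ n (G : Fin n → A → Carrier) → Φ (λ x → ∑ n (λ i → G i x)) ≈ ∑ n (λ i → Φ (G i))
    Φ-∑ zero    G = Φ-0
    Φ-∑ (suc n) G = trans (Φ-+ _ _) (+-congˡ (Φ-∑ n (G ∘ Fin.suc)))

    Φ-∑³ : ∀ k lo hi lo′ hi′ (c : (i α : ℕ) → Fin (k α) → Carrier)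
             (G : (i α : ℕ) → Fin (k α) → A → Carrier) →
           Φ (λ x → ∑³ k lo hi lo′ hi′ (λ i α p → c i α p *ᴷ G i α p x)) ≈
           ∑³ k lo hi lo′ hi′ (λ i α p → c i α p *ᴷ Φ (G i α p))
    Φ-∑³ k lo hi lo′ hi′ c G =
      trans (Φ-∑ (suc hi ∸ lo) _)
        (∑-cong (suc hi ∸ lo) (λ s → let i = lo + toℕ s in
          trans (Φ-∑ (suc (hi′ i) ∸ lo′ i) _)
            (∑-cong (suc (hi′ i) ∸ lo′ i) (λ t → let α = lo′ i + toℕ t in
              trans (Φ-∑ (k α) (λ p x → c i α p *ᴷ G i α p x))
                (∑-cong (k α) (λ p → Φ-* (c i α p) (G i α p)))))))

module MatrixPowers {c ℓ} (F : Field c ℓ) {d : ℕ} (N : LinAlg.Mat F d d) where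
  open Field F renaming (_+_ to _+ᴷ_; _*_ to _*ᴷ_)
  open LinAlg F
  open FieldSums F
  open import Relation.Binary.Reasoning.Setoid setoid

  infix 4 _≋_
  _≋_ : Vector d → Vector d → Set ℓ
  v ≋ w = ∀ e → v e ≈ w e

  ·-cong : ∀ {v w} → v ≋ w → N · v ≋ N · w
  ·-cong v≋w e = ∑-cong d (λ j → *-congˡ (v≋w j))

  ·-distrib-+ : ∀ v w → N · (λ x → v x +ᴷ w x) ≋ (λ e → (N · v) e +ᴷ (N · w) e)
  ·-distrib-+ v w e = trans (∑-cong d (λ j → distribˡ _ _ _)) (∑-distrib-+ d _ _)

  ·-homo-* : ∀ r v → N · (λ x → r *ᴷ v x) ≋ (λ e → r *ᴷ (N · v) e)
  ·-homo-* r v e =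
    trans (∑-cong d (λ j → trans (sym (*-assoc _ _ _))
                           (trans (*-congʳ (*-comm _ r)) (*-assoc _ _ _))))
          (sym (*-distribˡ-∑ d r _))

  ^·-cong : ∀ t {v w} → v ≋ w → N ^ t · v ≋ N ^ t · w
  ^·-cong zero    v≋w = v≋w
  ^·-cong (suc t) v≋w = ·-cong (^·-cong t v≋w)

  ^·-distrib-+ : ∀ t v w → N ^ t · (λ x → v x +ᴷ w x) ≋ (λ e → (N ^ t · v) e +ᴷ (N ^ t · w) e)
  ^·-distrib-+ zero    v w e = refl
  ^·-distrib-+ (suc t) v w e = trans (·-cong (^·-distrib-+ t v w) e) (·-distrib-+ _ _ e)

  ^·-homo-* : ∀ t r v → N ^ t · (λ x → r *ᴷ v x) ≋ (λ e → r *ᴷ (N ^ t · v) e)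
  ^·-homo-* zero    r v e = refl
  ^·-homo-* (suc t) r v e = trans (·-cong (^·-homo-* t r v) e) (·-homo-* _ _ e)

  module Linear^· (t : ℕ) (e : Fin d) =
    Linear (λ v → (N ^ t · v) e) (λ v≋w → ^·-cong t v≋w e)
           (λ v w → ^·-distrib-+ t v w e) (λ r v → ^·-homo-* t r v e)

  ^·-zero : ∀ t {v} → v ≋ (λ _ → 0#) → N ^ t · v ≋ (λ _ → 0#)
  ^·-zero t v≋0 e = trans (^·-cong t v≋0 e) (Linear^·.Φ-0 t e)

  ^·-+ : ∀ s t v → N ^ (s + t) · v ≋ N ^ s · (N ^ t · v)
  ^·-+ zero    t v e = refl
  ^·-+ (suc s) t v e = ·-cong (^·-+ s t v) e

  nilpotent⇒^·≈0 : ∀ {m t} → NilpotentOfOrder N m → m ≤ t → ∀ v → N ^ t · v ≋ (λ _ → 0#)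
  nilpotent⇒^·≈0 {m} {t} Nᵐ≈0 m≤t v e = begin
    (N ^ t · v) e                   ≡⟨ cong (λ t′ → (N ^ t′ · v) e) (≡.sym (ℕₚ.m∸n+n≡m m≤t)) ⟩
    (N ^ ((t ∸ m) + m) · v) e       ≈⟨ ^·-+ (t ∸ m) m v e ⟩
    (N ^ (t ∸ m) · (N ^ m · v)) e   ≈⟨ ^·-zero (t ∸ m) (Nᵐ≈0 v) e ⟩
    0#                              ∎

module Coordinates {c ℓ} (F : Field c ℓ) {d : ℕ} (N : LinAlg.Mat F d d) (m : ℕ)
    (k : ℕ → ℕ) (l : (u : ℕ) → Fin (k u) → LinAlg.Vector F d)
    (spans : Setting.Spans F N m k l 0)
    (independent : Setting.Independent F N m k l 0) where
  open Field F renaming (_+_ to _+ᴷ_; _*_ to _*ᴷ_)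
  open LinAlg F
  open Setting F N m k l
  open FieldSums F
  open MatrixPowers F N using (_≋_)
  open import Algebra.Properties.Ring ring using (-1*x≈-x; x∙y⁻¹≈ε⇒x≈y; -‿distribˡ-*)
  open import Relation.Binary.Reasoning.Setoid setoid

  BasisIndex : ℕ → ℕ → Set
  BasisIndex = Within k 0 (m ∸ 1) (_+ 2) (λ _ → suc m)

  combo-cong : ∀ u0 {cf cf′ : Coeffs} → (∀ α β γ → cf α β γ ≈ cf′ α β γ) →
               combo u0 cf ≋ combo u0 cf′
  combo-cong u0 cf≈cf′ e =
    ∑³-cong k u0 (m ∸ 1) (_+ 2) (λ _ → suc m) (λ α β γ _ → *-congʳ {(N ^ α · l β γ) e} (cf≈cf′ α β γ))

  combo-+ : ∀ u0 (cf cf′ : Coeffs) →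
            combo u0 (λ α β γ → cf α β γ +ᴷ cf′ α β γ) ≋ (λ e → combo u0 cf e +ᴷ combo u0 cf′ e)
  combo-+ u0 cf cf′ e =
    trans (∑³-cong k u0 (m ∸ 1) (_+ 2) (λ _ → suc m) (λ α β γ _ →
             distribʳ ((N ^ α · l β γ) e) (cf α β γ) (cf′ α β γ)))
          (∑³-distrib-+ k u0 (m ∸ 1) (_+ 2) (λ _ → suc m)
             (λ α β γ → cf α β γ *ᴷ (N ^ α · l β γ) e) (λ α β γ → cf′ α β γ *ᴷ (N ^ α · l β γ) e))

  combo-* : ∀ u0 r (cf : Coeffs) → combo u0 (λ α β γ → r *ᴷ cf α β γ) ≋ (λ e → r *ᴷ combo u0 cf e)
  combo-* u0 r cf e =
    trans (∑³-cong k u0 (m ∸ 1) (_+ 2) (λ _ → suc m) (λ α β γ _ → *-assoc r (cf α β γ) ((N ^ α · l β γ) e)))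
          (sym (*-distribˡ-∑³ k u0 (m ∸ 1) (_+ 2) (λ _ → suc m) r
                  (λ α β γ → cf α β γ *ᴷ (N ^ α · l β γ) e)))

  coord : Vector d → Coeffs
  coord x = proj₁ (spans x)

  combo-coord : ∀ x → x ≋ combo 0 (coord x)
  combo-coord x = proj₂ (spans x)

  coord-unique : ∀ x (cf : Coeffs) → combo 0 cf ≋ x →
                 ∀ {α β} → BasisIndex α β → ∀ γ → cf α β γ ≈ coord x α β γ
  coord-unique x cf cf↦x {α} {β} ((_ , α≤) , (α+2≤β , β≤)) γ =
    x∙y⁻¹≈ε⇒x≈y (cf α β γ) (coord x α β γ) (independent difference difference↦0 α β γ z≤n α≤ α+2≤β β≤)
    where
    difference : Coeffs
    difference α β γ = cf α β γ +ᴷ - coord x α β γ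
    difference↦0 : combo 0 difference ≋ (λ _ → 0#)
    difference↦0 e = begin
      combo 0 difference e
        ≈⟨ combo-+ 0 cf (λ α β γ → - coord x α β γ) e ⟩
      combo 0 cf e +ᴷ combo 0 (λ α β γ → - coord x α β γ) e
        ≈⟨ +-congˡ (combo-cong 0 (λ α β γ → sym (-1*x≈-x (coord x α β γ))) e) ⟩
      combo 0 cf e +ᴷ combo 0 (λ α β γ → - 1# *ᴷ coord x α β γ) e
        ≈⟨ +-cong (cf↦x e) (trans (combo-* 0 (- 1#) (coord x) e) (-1*x≈-x _)) ⟩
      x e +ᴷ - combo 0 (coord x) e
        ≈⟨ +-congˡ (-‿cong (sym (combo-coord x e))) ⟩
      x e +ᴷ - x e
        ≈⟨ -‿inverseʳ _ ⟩
      0# ∎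

  module _ {α β : ℕ} (αβ : BasisIndex α β) (γ : Fin (k β)) where

    coord-cong : ∀ {x y} → x ≋ y → coord x α β γ ≈ coord y α β γ
    coord-cong {x} {y} x≋y =
      coord-unique y (coord x) (λ e → trans (sym (combo-coord x e)) (x≋y e)) αβ γ

    coord-+ : ∀ x y → coord (λ e → x e +ᴷ y e) α β γ ≈ coord x α β γ +ᴷ coord y α β γ
    coord-+ x y =
      sym (coord-unique (λ e → x e +ᴷ y e) (λ α β γ → coord x α β γ +ᴷ coord y α β γ) combo-sum αβ γ)
      where
      combo-sum : combo 0 (λ α β γ → coord x α β γ +ᴷ coord y α β γ) ≋ (λ e → x e +ᴷ y e)
      combo-sum e = trans (combo-+ 0 (coord x) (coord y) e)
                          (sym (+-cong (combo-coord x e) (combo-coord y e)))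

    coord-* : ∀ r x → coord (λ e → r *ᴷ x e) α β γ ≈ r *ᴷ coord x α β γ
    coord-* r x =
      sym (coord-unique (λ e → r *ᴷ x e) (λ α β γ → r *ᴷ coord x α β γ) combo-scaled αβ γ)
      where
      combo-scaled : combo 0 (λ α β γ → r *ᴷ coord x α β γ) ≋ (λ e → r *ᴷ x e)
      combo-scaled e = trans (combo-* 0 r (coord x) e) (*-congˡ (sym (combo-coord x e)))

    module LinearCoord = Linear (λ x → coord x α β γ) coord-cong coord-+ coord-*

  module _ {v α : ℕ} (vα : BasisIndex v α) (p : Fin (k α)) where

    private
      unitCoeffs : Coeffs
      unitCoeffs α′ β′ γ′ = if ⌊ α′ ≟ v ⌋ ∧ ⌊ β′ ≟ α ⌋ then δ (toℕ γ′) (toℕ p) else 0#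

      combo-unitCoeffs : combo 0 unitCoeffs ≋ N ^ v · l α p
      combo-unitCoeffs e = begin
        combo 0 unitCoeffs e
          ≈⟨ ∑³-single k 0 (m ∸ 1) (_+ 2) (λ _ → suc m) _ v α p vα off ⟩
        unitCoeffs v α p *ᴷ (N ^ v · l α p) e
          ≡⟨ cong (_*ᴷ _) (≡.trans (if-yes₂ (v ≟ v) (α ≟ α) (≡.refl , ≡.refl)) (δ-refl (toℕ p))) ⟩
        1# *ᴷ (N ^ v · l α p) e
          ≈⟨ *-identityˡ _ ⟩
        (N ^ v · l α p) e ∎
        where
        off : ∀ α′ β′ γ′ → BasisIndex α′ β′ → α′ ≢ v ⊎ β′ ≢ α ⊎ toℕ γ′ ≢ toℕ p →
              unitCoeffs α′ β′ γ′ *ᴷ (N ^ α′ · l β′ γ′) e ≈ 0#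
        off α′ β′ γ′ _ (inj₁ α′≢v) =
          trans (*-congʳ (reflexive (if-no₂ (α′ ≟ v) (β′ ≟ α) (α′≢v ∘ proj₁)))) (zeroˡ _)
        off α′ β′ γ′ _ (inj₂ (inj₁ β′≢α)) =
          trans (*-congʳ (reflexive (if-no₂ (α′ ≟ v) (β′ ≟ α) (β′≢α ∘ proj₂)))) (zeroˡ _)
        off α′ β′ γ′ _ (inj₂ (inj₂ γ′≢p)) with α′ ≟ v | β′ ≟ α
        ... | yes _ | yes _ = trans (*-congʳ (reflexive (δ-≢ γ′≢p))) (zeroˡ _)
        ... | yes _ | no _  = zeroˡ _
        ... | no _  | _     = zeroˡ _

      coord≈unitCoeffs : ∀ {α′ β′} → BasisIndex α′ β′ → ∀ γ′ →
                         coord (N ^ v · l α p) α′ β′ γ′ ≈ unitCoeffs α′ β′ γ′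
      coord≈unitCoeffs α′β′ γ′ = sym (coord-unique _ unitCoeffs combo-unitCoeffs α′β′ γ′)

    coord-basisVector-self : ∀ γ′ → coord (N ^ v · l α p) v α γ′ ≈ δ (toℕ γ′) (toℕ p)
    coord-basisVector-self γ′ =
      trans (coord≈unitCoeffs vα γ′) (reflexive (if-yes₂ (v ≟ v) (α ≟ α) (≡.refl , ≡.refl)))

    coord-basisVector-other : ∀ {α′ β′} → BasisIndex α′ β′ → ¬ (α′ ≡ v × β′ ≡ α) → ∀ γ′ →
                              coord (N ^ v · l α p) α′ β′ γ′ ≈ 0#
    coord-basisVector-other {α′} {β′} α′β′ ≢vα γ′ =
      trans (coord≈unitCoeffs α′β′ γ′) (reflexive (if-no₂ (α′ ≟ v) (β′ ≟ α) ≢vα))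

  module _ (P : Fam) (peq : PEq P) {α : ℕ} (1≤α : 1 ≤ α) (α≤1+m : α ≤ suc m)
           {v : ℕ} (v<m : v < m) (p : Fin (k α)) where

    private
      PCoeffs : Coeffs
      PCoeffs α′ β′ γ′ = if ⌊ v ≤? α′ ⌋ then - P α v β′ α′ p γ′ else 0#

      combo-PCoeffs : combo 0 PCoeffs ≋ N ^ v · l α p
      combo-PCoeffs e = begin
        combo 0 PCoeffs e
          ≈⟨ ∑[⋯]-dropˡ 0 v (m ∸ 1) _ z≤n (ℕₚ.≤-trans (ℕₚ.<⇒≤ v<m) (ℕₚ.m≤n+m∸n m 1)) below ⟩
        ∑³ k v (m ∸ 1) (_+ 2) (λ _ → suc m) (λ α′ β′ γ′ → PCoeffs α′ β′ γ′ *ᴷ (N ^ α′ · l β′ γ′) e)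
          ≈⟨ ∑³-cong k v (m ∸ 1) (_+ 2) (λ _ → suc m) above ⟩
        ∑³ k v (m ∸ 1) (_+ 2) (λ _ → suc m) (λ α′ β′ γ′ → - (P α v β′ α′ p γ′ *ᴷ (N ^ α′ · l β′ γ′) e))
          ≈⟨ -‿distrib-∑³ k v (m ∸ 1) (_+ 2) (λ _ → suc m)
               (λ α′ β′ γ′ → P α v β′ α′ p γ′ *ᴷ (N ^ α′ · l β′ γ′) e) ⟩
        - rhs P α v p e
          ≈⟨ peq α v 1≤α α≤1+m v<m p e ⟨
        (N ^ v · l α p) e ∎
        where
        below : ∀ α′ → 0 ≤ α′ → α′ < v →
                ∑[ α′ + 2 ⋯ suc m ] (λ β′ → ∑ (k β′) (λ γ′ → PCoeffs α′ β′ γ′ *ᴷ (N ^ α′ · l β′ γ′) e)) ≈ 0#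
        below α′ _ α′<v = ∑[⋯]-zero (α′ + 2) (suc m) (λ β′ _ → ∑-zero (k β′) (λ γ′ →
          trans (*-congʳ (reflexive (if-no (v ≤? α′) {x = - P α v β′ α′ p γ′} (ℕₚ.<⇒≱ α′<v))))
                (zeroˡ ((N ^ α′ · l β′ γ′) e))))
        above : ∀ α′ β′ γ′ → Within k v (m ∸ 1) (_+ 2) (λ _ → suc m) α′ β′ →
                PCoeffs α′ β′ γ′ *ᴷ (N ^ α′ · l β′ γ′) e ≈ - (P α v β′ α′ p γ′ *ᴷ (N ^ α′ · l β′ γ′) e)
        above α′ β′ γ′ ((v≤α′ , _) , _) =
          trans (*-congʳ (reflexive (if-yes (v ≤? α′) v≤α′))) (sym (-‿distribˡ-* _ _))

      coord≈PCoeffs : ∀ {α′ β′} → BasisIndex α′ β′ → ∀ γ′ →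
                      coord (N ^ v · l α p) α′ β′ γ′ ≈ PCoeffs α′ β′ γ′
      coord≈PCoeffs α′β′ γ′ = sym (coord-unique _ PCoeffs combo-PCoeffs α′β′ γ′)

    coord-PEq : ∀ {α′ β′} → BasisIndex α′ β′ → v ≤ α′ → ∀ γ′ →
                coord (N ^ v · l α p) α′ β′ γ′ ≈ - P α v β′ α′ p γ′
    coord-PEq {α′} α′β′ v≤α′ γ′ = trans (coord≈PCoeffs α′β′ γ′) (reflexive (if-yes (v ≤? α′) v≤α′))

    coord-PEq-below : ∀ {α′ β′} → BasisIndex α′ β′ → α′ < v → ∀ γ′ →
                      coord (N ^ v · l α p) α′ β′ γ′ ≈ 0#
    coord-PEq-below {α′} α′β′ α′<v γ′ =
      trans (coord≈PCoeffs α′β′ γ′) (reflexive (if-no (v ≤? α′) (ℕₚ.<⇒≱ α′<v)))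

module IndexArithmetic where

  1+m∸n≡1+[m∸n] : ∀ {m n} → n ≤ m → suc m ∸ n ≡ suc (m ∸ n)
  1+m∸n≡1+[m∸n] = ℕₚ.+-∸-assoc 1

  m∸[1+n]+2≡1+m∸n : ∀ {m n} → n < m → m ∸ suc n + 2 ≡ suc m ∸ n
  m∸[1+n]+2≡1+m∸n {suc m} {zero}  _         = ℕₚ.+-comm m 2
  m∸[1+n]+2≡1+m∸n {suc m} {suc n} (s≤s n<m) = m∸[1+n]+2≡1+m∸n n<m

  m∸[1+[n∸i]]≡m∸[1+n]+i : ∀ {m n i} → i ≤ n → n < m → m ∸ suc (n ∸ i) ≡ m ∸ suc n + i
  m∸[1+[n∸i]]≡m∸[1+n]+i {m} {n} {i} i≤n n<m = begin
    m ∸ suc (n ∸ i)                   ≡⟨ cong (_∸ suc (n ∸ i)) (ℕₚ.m∸n+n≡m n<m) ⟨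
    m ∸ suc n + suc n ∸ suc (n ∸ i)   ≡⟨ ℕₚ.+-∸-assoc (m ∸ suc n) (s≤s (ℕₚ.m∸n≤m n i)) ⟩
    m ∸ suc n + (n ∸ (n ∸ i))         ≡⟨ cong (m ∸ suc n +_) (ℕₚ.m∸[m∸n]≡n i≤n) ⟩
    m ∸ suc n + i                     ∎
    where open ≡.≡-Reasoning

  pred≡⇒≡suc : ∀ {α i} → 1 ≤ α → pred α ≡ i → α ≡ suc i
  pred≡⇒≡suc (s≤s _) ≡.refl = ≡.refl

  i+2≰i+1 : ∀ {i α} → i + 2 ≤ α → α ≤ suc i → ⊥
  i+2≰i+1 {i} i+2≤α α≤1+i =
    ℕₚ.<-irrefl ≡.refl (ℕₚ.≤-trans (ℕₚ.≤-reflexive (ℕₚ.+-comm 2 i)) (ℕₚ.≤-trans i+2≤α α≤1+i))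

  <⇒≤pred : ∀ {i m} → i < m → i ≤ m ∸ 1
  <⇒≤pred {m = suc m} (s≤s i≤m) = i≤m

  ≤pred⇒< : ∀ {i m} → 1 ≤ m → i ≤ m ∸ 1 → i < m
  ≤pred⇒< {m = suc m} _ i≤m = s≤s i≤m

  i+2≤⇒pred≢ : ∀ {i α} → i + 2 ≤ α → pred α ≢ i
  i+2≤⇒pred≢ {i} {α} i+2≤α pα≡i =
    ℕₚ.<-irrefl ≡.refl (ℕₚ.≤-trans (ℕₚ.pred-mono-≤ (ℕₚ.≤-trans (ℕₚ.≤-reflexive (ℕₚ.+-comm 2 i)) i+2≤α))
                                    (ℕₚ.≤-reflexive pα≡i))

  m∸[n∸i]<i : ∀ {m n i} → n ∸ i ≤ m → m < n → i ≤ n → m ∸ (n ∸ i) < i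
  m∸[n∸i]<i {m} {n} {i} n∸i≤m m<n i≤n = ℕₚ.+-cancelʳ-< (n ∸ i) (m ∸ (n ∸ i)) i
    (≡.subst₂ _<_ (≡.sym (ℕₚ.m∸n+n≡m n∸i≤m)) (≡.sym (ℕₚ.m+[n∸m]≡n i≤n)) m<n)

module Blocks {c ℓ} (F : Field c ℓ) {d : ℕ} (N : LinAlg.Mat F d d) (m : ℕ)
    (k : ℕ → ℕ) (l : (u : ℕ) → Fin (k u) → LinAlg.Vector F d)
    (S P : Setting.Fam F N m k l) where
  open Field F renaming (_+_ to _+ᴷ_; _*_ to _*ᴷ_)
  open LinAlg F
  open Setting F N m k l
  open FieldSums F
  open IndexArithmetic
  open import Relation.Binary.Reasoning.Setoid setoid

  -- Entries with the row block α and the column block B + 1 as natural numbers: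
  -- C S i (a , p) (b , q) is C-entry i (suc (toℕ a)) p (toℕ b) q by definition.
  C-entry : ℕ → (α : ℕ) → Fin (k α) → (B : ℕ) → Fin (k (suc m ∸ B)) → Carrier
  C-entry i α p B q =
    if ⌊ i ≤? m ⌋ ∧ ⌊ pred α ≟ i ⌋ ∧ ⌊ B ≟ m ∸ i ⌋ then δ (toℕ p) (toℕ q)
    else if ⌊ 2 ≤? suc B ⌋ ∧ ⌊ (m + 1) ∸ suc B ≤? i ⌋ ∧ ⌊ suc i ≤? m ⌋ ∧ ⌊ i + 2 ≤? α ⌋
      then S (suc m ∸ B) (m ∸ B) α i q p
    else 0#

  C̄-entry : ℕ → (α : ℕ) → Fin (k α) → (B : ℕ) → Fin (k (suc m ∸ B)) → Carrier
  C̄-entry j α p B q =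
    if ⌊ j ≤? m ⌋ ∧ ⌊ pred α ≟ m ∸ j ⌋ ∧ ⌊ B ≟ j ⌋ then δ (toℕ p) (toℕ q)
    else if ⌊ suc j ≤? m ⌋ ∧ ⌊ α ≤? m ∸ j ⌋ ∧ ⌊ suc B ≤? suc j ⌋
      then - P α (m ∸ suc j) (suc m ∸ B) (m ∸ suc B) p q
    else 0#

  module _ {i α : ℕ} {p : Fin (k α)} {B : ℕ} {q : Fin (k (suc m ∸ B))} where

    C-entry-0 : ¬ (i ≤ m × pred α ≡ i × B ≡ m ∸ i) →
                ¬ (2 ≤ suc B × (m + 1) ∸ suc B ≤ i × suc i ≤ m × i + 2 ≤ α) → C-entry i α p B q ≡ 0#
    C-entry-0 ¬identity ¬S =
      ≡.trans (if-no₃ (i ≤? m) (pred α ≟ i) (B ≟ m ∸ i) ¬identity)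
              (if-no₄ (2 ≤? suc B) ((m + 1) ∸ suc B ≤? i) (suc i ≤? m) (i + 2 ≤? α) ¬S)

    C-entry-vanishes : 1 ≤ α → α ≤ i → C-entry i α p B q ≡ 0#
    C-entry-vanishes 1≤α α≤i = C-entry-0
      (λ (_ , pα≡i , _) → ℕₚ.<-irrefl ≡.refl (ℕₚ.≤-trans (ℕₚ.≤-reflexive (≡.sym (pred≡⇒≡suc 1≤α pα≡i))) α≤i))
      (λ (_ , _ , _ , i+2≤α) → i+2≰i+1 i+2≤α (ℕₚ.≤-trans α≤i (ℕₚ.n≤1+n i)))

  module _ {j α : ℕ} {p : Fin (k α)} {B : ℕ} {q : Fin (k (suc m ∸ B))} where

    C̄-entry-0 : ¬ (j ≤ m × pred α ≡ m ∸ j × B ≡ j) →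
                ¬ (suc j ≤ m × α ≤ m ∸ j × suc B ≤ suc j) → C̄-entry j α p B q ≡ 0#
    C̄-entry-0 ¬identity ¬P =
      ≡.trans (if-no₃ (j ≤? m) (pred α ≟ m ∸ j) (B ≟ j) ¬identity)
              (if-no₃ (suc j ≤? m) (α ≤? m ∸ j) (suc B ≤? suc j) ¬P)

    C̄-entry-identity : j ≤ m → α ≡ suc (m ∸ j) → B ≡ j → C̄-entry j α p B q ≡ δ (toℕ p) (toℕ q)
    C̄-entry-identity j≤m α≡ B≡j = if-yes₃ (j ≤? m) (pred α ≟ m ∸ j) (B ≟ j) (j≤m , cong pred α≡ , B≡j)

    C̄-entry-P : 1 ≤ α → j < m → α ≤ m ∸ j → B ≤ j →
                C̄-entry j α p B q ≡ - P α (m ∸ suc j) (suc m ∸ B) (m ∸ suc B) p q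
    C̄-entry-P 1≤α j<m α≤m∸j B≤j =
      ≡.trans (if-no₃ (j ≤? m) (pred α ≟ m ∸ j) (B ≟ j)
                 (λ (_ , pα≡ , _) → ℕₚ.<-irrefl ≡.refl
                    (ℕₚ.≤-trans (ℕₚ.≤-reflexive (≡.sym (pred≡⇒≡suc 1≤α pα≡))) α≤m∸j)))
              (if-yes₃ (suc j ≤? m) (α ≤? m ∸ j) (suc B ≤? suc j) (j<m , α≤m∸j , s≤s B≤j))

    C̄-entry-vanishes : suc (m ∸ j) < α → C̄-entry j α p B q ≡ 0#
    C̄-entry-vanishes 1+m∸j<α = C̄-entry-0
      (λ (_ , pα≡ , _) → ℕₚ.<⇒≱ 1+m∸j<α (ℕₚ.≤-reflexive (pred≡⇒≡suc (ℕₚ.≤-trans (s≤s z≤n) 1+m∸j<α) pα≡)))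
      (λ (_ , α≤m∸j , _) → ℕₚ.<⇒≱ 1+m∸j<α (ℕₚ.≤-trans α≤m∸j (ℕₚ.n≤1+n _)))

    C̄-entry-vanishes-above : m < j → C̄-entry j α p B q ≡ 0#
    C̄-entry-vanishes-above m<j = C̄-entry-0
      (λ (j≤m , _) → ℕₚ.<⇒≱ m<j j≤m)
      (λ (j<m , _) → ℕₚ.<-asym m<j j<m)

    C̄-entry-lastColumn : j < m → m ≤ B → C̄-entry j α p B q ≡ 0#
    C̄-entry-lastColumn j<m m≤B = C̄-entry-0
      (λ (_ , _ , B≡j) → ℕₚ.<⇒≱ j<m (subst (m ≤_) B≡j m≤B))
      (λ (_ , _ , B<1+j) → ℕₚ.<⇒≱ j<m (ℕₚ.≤-trans m≤B (ℕₚ.≤-pred B<1+j)))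

  productTerm : ℕ → (B : ℕ) → Fin (k (suc m ∸ B)) → (B′ : ℕ) → Fin (k (suc m ∸ B′)) →
                (i α : ℕ) → Fin (k α) → Carrier
  productTerm n B q B′ q′ i α p = C-entry i α p B q *ᴷ C̄-entry (n ∸ i) α p B′ q′

  productSum : ℕ → (B : ℕ) → Fin (k (suc m ∸ B)) → (B′ : ℕ) → Fin (k (suc m ∸ B′)) → Carrier
  productSum n B q B′ q′ = ∑³ k 0 n (λ _ → 1) (λ _ → suc m) (productTerm n B q B′ q′)

  productCoeff≡productSum : ∀ n b q b′ q′ →
                            productCoeff S P n (b , q) (b′ , q′) ≡ productSum n (toℕ b) q (toℕ b′) q′
  productCoeff≡productSum n b q b′ q′ = ≡.refl

  module _ {B : ℕ} (q : Fin (k (suc m ∸ B))) {B′ : ℕ} (q′ : Fin (k (suc m ∸ B′))) where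

    -- A term needs i < α (for Cᵢ) and α ≤ m + 1 - (n - i) (for C̄ₙ₋ᵢ), impossible when n > m.
    productSum-above : ∀ {n} → m < n → productSum n B q B′ q′ ≈ 0#
    productSum-above {n} m<n =
      ∑³-zero k 0 n (λ _ → 1) (λ _ → suc m) (productTerm n B q B′ q′) (λ i α p ((_ , i≤n) , (1≤α , _)) →
        case α ≤? i of λ where
          (yes α≤i) → trans (*-congʳ (reflexive (C-entry-vanishes 1≤α α≤i))) (zeroˡ _)
          (no α≰i)  → trans (*-congˡ (reflexive (C̄-vanishes i≤n (ℕₚ.≰⇒> α≰i)))) (zeroʳ _))
      where
      C̄-vanishes : ∀ {i α} {p : Fin (k α)} → i ≤ n → i < α → C̄-entry (n ∸ i) α p B′ q′ ≡ 0#
      C̄-vanishes {i} i≤n i<α = case m <? n ∸ i of λ where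
        (yes m<n∸i) → C̄-entry-vanishes-above m<n∸i
        (no m≮n∸i)  → C̄-entry-vanishes {n ∸ i} (ℕₚ.<-≤-trans (s≤s (m∸[n∸i]<i (ℕₚ.≮⇒≥ m≮n∸i) m<n i≤n)) i<α)

    productSum-m≈C-entry : B′ ≤ m → productSum m B q B′ q′ ≈ C-entry (m ∸ B′) (suc m ∸ B′) q′ B q
    productSum-m≈C-entry B′≤m =
      trans (∑³-single k 0 m (λ _ → 1) (λ _ → suc m) (productTerm m B q B′ q′) i₀ α₀ q′ within off)
            (trans (*-congˡ (reflexive (≡.trans (C̄-entry-identity (ℕₚ.m∸n≤m m i₀) α₀≡ (≡.sym m∸i₀≡B′))
                                                (δ-refl (toℕ q′)))))
                   (*-identityʳ _))
      where
      i₀ α₀ : ℕ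
      i₀ = m ∸ B′
      α₀ = suc m ∸ B′
      m∸i₀≡B′ : m ∸ i₀ ≡ B′
      m∸i₀≡B′ = ℕₚ.m∸[m∸n]≡n B′≤m
      α₀≡ : α₀ ≡ suc (m ∸ (m ∸ i₀))
      α₀≡ = ≡.trans (1+m∸n≡1+[m∸n] B′≤m) (cong (λ B″ → suc (m ∸ B″)) (≡.sym m∸i₀≡B′))
      within : Within k 0 m (λ _ → 1) (λ _ → suc m) i₀ α₀
      within = (z≤n , ℕₚ.m∸n≤m m B′)
             , (subst (1 ≤_) (≡.sym (1+m∸n≡1+[m∸n] B′≤m)) (s≤s z≤n) , ℕₚ.m∸n≤m (suc m) B′)
      off : ∀ i α p → Within k 0 m (λ _ → 1) (λ _ → suc m) i α → i ≢ i₀ ⊎ α ≢ α₀ ⊎ toℕ p ≢ toℕ q′ →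
            C-entry i α p B q *ᴷ C̄-entry (m ∸ i) α p B′ q′ ≈ 0#
      off i α p ((_ , i≤m) , (1≤α , _)) elsewhere = by-cases (α ≤? i)
        where
        m∸[m∸i]≡i : m ∸ (m ∸ i) ≡ i
        m∸[m∸i]≡i = ℕₚ.m∸[m∸n]≡n i≤m
        i≡i₀ : B′ ≡ m ∸ i → i ≡ i₀
        i≡i₀ B′≡m∸i = ≡.trans (≡.sym m∸[m∸i]≡i) (cong (m ∸_) (≡.sym B′≡m∸i))
        C̄-off : i < α → C̄-entry (m ∸ i) α p B′ q′ ≡ 0#
        C̄-off i<α = case (α ≟ suc i) ×-dec (B′ ≟ m ∸ i) of λ where
          (no ¬identity) → C̄-entry-0
            (λ (_ , pα≡ , B′≡) → ¬identity (≡.trans (pred≡⇒≡suc 1≤α pα≡) (cong suc m∸[m∸i]≡i) , B′≡))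
            (λ (_ , α≤ , _) → ℕₚ.<⇒≱ i<α (ℕₚ.≤-trans α≤ (ℕₚ.≤-reflexive m∸[m∸i]≡i)))
          (yes (α≡1+i , B′≡m∸i)) →
            ≡.trans (C̄-entry-identity (ℕₚ.m∸n≤m m i) (≡.trans α≡1+i (cong suc (≡.sym m∸[m∸i]≡i))) B′≡m∸i)
                    (δ-≢ ([ (λ i≢i₀ → ⊥-elim (i≢i₀ (i≡i₀ B′≡m∸i)))
                          , [ (λ α≢α₀ → ⊥-elim (α≢α₀ (≡.trans α≡1+i (≡.trans (cong suc (i≡i₀ B′≡m∸i))
                                                                          (≡.sym (1+m∸n≡1+[m∸n] B′≤m))))))
                            , (λ p≢q′ → p≢q′) ] ] elsewhere))
        by-cases : Dec (α ≤ i) → C-entry i α p B q *ᴷ C̄-entry (m ∸ i) α p B′ q′ ≈ 0#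
        by-cases (yes α≤i) = trans (*-congʳ (reflexive (C-entry-vanishes 1≤α α≤i))) (zeroˡ _)
        by-cases (no α≰i)  = trans (*-congˡ (reflexive (C̄-off (ℕₚ.≰⇒> α≰i)))) (zeroʳ _)

  module _ (b : Fin (suc m)) (q : Fin (k (suc m ∸ toℕ b)))
           (b′ : Fin (suc m)) (q′ : Fin (k (suc m ∸ toℕ b′))) where

    private
      B B′ : ℕ
      B  = toℕ b
      B′ = toℕ b′

      B′≤m : B′ ≤ m
      B′≤m = ℕₚ.≤-pred (Finₚ.toℕ<n b′)

      1+[m∸B′]≡ : suc (m ∸ B′) ≡ suc m ∸ B′
      1+[m∸B′]≡ = ≡.sym (1+m∸n≡1+[m∸n] B′≤m)

      same-column : (b≡b′ : b ≡ b′) → C-entry (m ∸ B′) (suc m ∸ B′) q′ B q ≡ I (b , q) (b′ , q′)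
      same-column ≡.refl = ≡.trans
        (if-yes₃ ((m ∸ B′) ≤? m) (pred (suc m ∸ B′) ≟ m ∸ B′) (B ≟ m ∸ (m ∸ B′))
                 (ℕₚ.m∸n≤m m B′ , cong pred (≡.sym 1+[m∸B′]≡) , ≡.sym (ℕₚ.m∸[m∸n]≡n B′≤m)))
        (case toℕ q′ ≟ toℕ q of λ where
          (yes q′≡q) → ≡.trans (if-yes (toℕ q′ ≟ toℕ q) q′≡q)
                                (≡.sym (if-yes (≡-dec Fin._≟_ Fin._≟_ (b , q) (b , q′))
                                               (cong (b ,_) (Finₚ.toℕ-injective (≡.sym q′≡q)))))
          (no q′≢q) → ≡.trans (δ-≢ q′≢q)
                               (≡.sym (if-no (≡-dec Fin._≟_ Fin._≟_ (b , q) (b , q′))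
                                             (λ eq → q′≢q (≡.sym (cong (λ x → toℕ (proj₂ x)) eq))))))

      other-column : b ≢ b′ → C-entry (m ∸ B′) (suc m ∸ B′) q′ B q ≡ I (b , q) (b′ , q′)
      other-column b≢b′ = ≡.trans
        (C-entry-0 (λ (_ , _ , B≡) → b≢b′ (Finₚ.toℕ-injective (≡.trans B≡ (ℕₚ.m∸[m∸n]≡n B′≤m))))
                   (λ (_ , _ , _ , i₀+2≤α₀) → i+2≰i+1 i₀+2≤α₀ (ℕₚ.≤-reflexive (≡.sym 1+[m∸B′]≡))))
        (≡.sym (if-no (≡-dec Fin._≟_ Fin._≟_ (b , q) (b′ , q′)) (λ eq → b≢b′ (cong proj₁ eq))))

    productSum-m≈I : productSum m B q B′ q′ ≈ I (b , q) (b′ , q′)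
    productSum-m≈I =
      trans (productSum-m≈C-entry q q′ B′≤m)
            (reflexive (case b Fin.≟ b′ of λ where
              (yes b≡b′) → same-column b≡b′
              (no b≢b′)  → other-column b≢b′))

  module _ (nilpotent : NilpotentOfOrder N m) (seq : SEq S) where
    open MatrixPowers F N using (nilpotent⇒^·≈0)

    ColumnRelation : (B : ℕ) → Fin (k (suc m ∸ B)) → Fin d → Carrier
    ColumnRelation B q e =
      ∑³ k 0 m (λ _ → 1) (λ _ → suc m) (λ i α p → C-entry i α p B q *ᴷ (N ^ i · l α p) e)

    private
      module ColumnParts {B : ℕ} (B≤m : B ≤ m) (q : Fin (k (suc m ∸ B))) (e : Fin d) where

        identityPart SPart : ℕ → (α : ℕ) → Fin (k α) → Carrier
        identityPart i α p = if ⌊ i ≤? m ⌋ ∧ ⌊ pred α ≟ i ⌋ ∧ ⌊ B ≟ m ∸ i ⌋ then δ (toℕ p) (toℕ q) else 0#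
        SPart i α p =
          if ⌊ 2 ≤? suc B ⌋ ∧ ⌊ (m + 1) ∸ suc B ≤? i ⌋ ∧ ⌊ suc i ≤? m ⌋ ∧ ⌊ i + 2 ≤? α ⌋
            then S (suc m ∸ B) (m ∸ B) α i q p else 0#

        weighted : ((i α : ℕ) → Fin (k α) → Carrier) → (i α : ℕ) → Fin (k α) → Carrier
        weighted f i α p = f i α p *ᴷ (N ^ i · l α p) e

        ∑³[_] : ((i α : ℕ) → Fin (k α) → Carrier) → Carrier
        ∑³[ f ] = ∑³ k 0 m (λ _ → 1) (λ _ → suc m) (weighted f)

        relation-split : ColumnRelation B q e ≈ ∑³[ identityPart ] +ᴷ ∑³[ SPart ]
        relation-split =
          trans (∑³-cong k 0 m (λ _ → 1) (λ _ → suc m) (λ i α p _ →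
                   trans (*-congʳ (if-else-split _ _ (exclusive i α)))
                         (distribʳ ((N ^ i · l α p) e) (identityPart i α p) (SPart i α p))))
                (∑³-distrib-+ k 0 m (λ _ → 1) (λ _ → suc m) (weighted identityPart) (weighted SPart))
          where
          exclusive : ∀ i α → (⌊ i ≤? m ⌋ ∧ ⌊ pred α ≟ i ⌋ ∧ ⌊ B ≟ m ∸ i ⌋) ≡ true →
                      (⌊ 2 ≤? suc B ⌋ ∧ ⌊ (m + 1) ∸ suc B ≤? i ⌋ ∧ ⌊ suc i ≤? m ⌋ ∧ ⌊ i + 2 ≤? α ⌋) ≡ false
          exclusive i α identity
            with (_ , pα≡i , _) ← ⌊⌋≡true⇒ _
                   (≡.trans (≡.sym (⌊⌋-∧₃ (i ≤? m) (pred α ≟ i) (B ≟ m ∸ i))) identity)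
            = ≡.trans (⌊⌋-∧₄ (2 ≤? suc B) ((m + 1) ∸ suc B ≤? i) (suc i ≤? m) (i + 2 ≤? α))
                      (⌊⌋≡false _ (λ (_ , _ , _ , i+2≤α) → i+2≤⇒pred≢ i+2≤α pα≡i))

        identity-sum : ∑³[ identityPart ] ≈ (N ^ (m ∸ B) · l (suc m ∸ B) q) e
        identity-sum = begin
          ∑³[ identityPart ]
            ≈⟨ ∑³-single k 0 m (λ _ → 1) (λ _ → suc m) (weighted identityPart) (m ∸ B) (suc m ∸ B) q
                 ((z≤n , ℕₚ.m∸n≤m m B) , (subst (1 ≤_) (≡.sym 1+m∸B≡) (s≤s z≤n) , ℕₚ.m∸n≤m (suc m) B))
                 off ⟩
          identityPart (m ∸ B) (suc m ∸ B) q *ᴷ (N ^ (m ∸ B) · l (suc m ∸ B) q) e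
            ≡⟨ cong (_*ᴷ _) (≡.trans (if-yes₃ ((m ∸ B) ≤? m) (pred (suc m ∸ B) ≟ m ∸ B) (B ≟ m ∸ (m ∸ B))
                                        (ℕₚ.m∸n≤m m B , cong pred 1+m∸B≡ , ≡.sym (ℕₚ.m∸[m∸n]≡n B≤m)))
                                     (δ-refl (toℕ q))) ⟩
          1# *ᴷ (N ^ (m ∸ B) · l (suc m ∸ B) q) e
            ≈⟨ *-identityˡ _ ⟩
          (N ^ (m ∸ B) · l (suc m ∸ B) q) e ∎
          where
          1+m∸B≡ : suc m ∸ B ≡ suc (m ∸ B)
          1+m∸B≡ = 1+m∸n≡1+[m∸n] B≤m
          off : ∀ i α p → Within k 0 m (λ _ → 1) (λ _ → suc m) i α →
                i ≢ m ∸ B ⊎ α ≢ suc m ∸ B ⊎ toℕ p ≢ toℕ q → weighted identityPart i α p ≈ 0#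
          off i α p (_ , (1≤α , _)) elsewhere with (i ≤? m) ×-dec (pred α ≟ i) ×-dec (B ≟ m ∸ i)
          ... | no ¬identity =
            trans (*-congʳ (reflexive (if-no₃ (i ≤? m) (pred α ≟ i) (B ≟ m ∸ i) ¬identity))) (zeroˡ _)
          ... | yes identity@(i≤m , pα≡i , B≡m∸i) =
            [ (λ i≢m∸B → ⊥-elim (i≢m∸B i≡m∸B))
            , [ (λ α≢ → ⊥-elim (α≢ (≡.trans (pred≡⇒≡suc 1≤α pα≡i) (≡.trans (cong suc i≡m∸B) (≡.sym 1+m∸B≡)))))
              , (λ p≢q → trans (*-congʳ (reflexive (≡.trans (if-yes₃ (i ≤? m) (pred α ≟ i) (B ≟ m ∸ i) identity)
                                                            (δ-≢ p≢q))))
                               (zeroˡ _)) ] ] elsewhere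
            where
            i≡m∸B : i ≡ m ∸ B
            i≡m∸B = ≡.trans (≡.sym (ℕₚ.m∸[m∸n]≡n i≤m)) (cong (m ∸_) (≡.sym B≡m∸i))

        SPart-off : ∀ i α p → ¬ (2 ≤ suc B × (m + 1) ∸ suc B ≤ i × suc i ≤ m × i + 2 ≤ α) →
                    weighted SPart i α p ≈ 0#
        SPart-off i α p ¬guard =
          trans (*-congʳ (reflexive
                  (if-no₄ (2 ≤? suc B) ((m + 1) ∸ suc B ≤? i) (suc i ≤? m) (i + 2 ≤? α) ¬guard)))
                (zeroˡ _)

        SPart-sum-col0 : B ≡ 0 → ∑³[ SPart ] ≈ 0#
        SPart-sum-col0 B≡0 = ∑³-zero k 0 m (λ _ → 1) (λ _ → suc m) (weighted SPart) (λ i α p _ →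
          SPart-off i α p (λ (2≤1+B , _) → ℕₚ.<-irrefl (≡.sym B≡0) (ℕₚ.≤-pred 2≤1+B)))

        module _ (1≤B : 1 ≤ B) where

          private
            1≤m : 1 ≤ m
            1≤m = ℕₚ.≤-trans 1≤B B≤m

            [m+1]∸[1+B]≡m∸B : (m + 1) ∸ suc B ≡ m ∸ B
            [m+1]∸[1+B]≡m∸B = cong (_∸ suc B) (ℕₚ.+-comm m 1)

            row : ℕ → Carrier
            row i = ∑[ 1 ⋯ suc m ] (λ α → ∑ (k α) (weighted SPart i α))

            rhs-row : ℕ → Carrier
            rhs-row z = ∑[ z + 2 ⋯ suc m ] (λ y →
              ∑ (k y) (λ j → S (suc m ∸ B) (m ∸ B) y z q j *ᴷ (N ^ z · l y j) e))

            row≈rhs-row : ∀ i → i ∈[ m ∸ B ⋯ m ∸ 1 ] → row i ≈ rhs-row i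
            row≈rhs-row i (m∸B≤i , i≤m∸1) = begin
              row i
                ≈⟨ ∑[⋯]-dropˡ 1 (i + 2) (suc m) _ (ℕₚ.≤-trans (s≤s z≤n) (ℕₚ.≤-reflexive (ℕₚ.+-comm 2 i)))
                     (ℕₚ.≤-trans (ℕₚ.≤-reflexive (ℕₚ.+-comm i 2)) (s≤s (s≤s (ℕₚ.<⇒≤ i<m))))
                     (λ α _ α<i+2 → ∑-zero (k α) (λ p →
                        SPart-off i α p (λ (_ , _ , _ , i+2≤α) → ℕₚ.<⇒≱ α<i+2 i+2≤α))) ⟩
              ∑[ i + 2 ⋯ suc m ] (λ α → ∑ (k α) (weighted SPart i α))
                ≈⟨ ∑[⋯]-cong (i + 2) (suc m) (λ α (i+2≤α , _) → ∑-cong (k α) (λ p →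
                     *-congʳ {(N ^ i · l α p) e} (reflexive
                       (if-yes₄ (2 ≤? suc B) ((m + 1) ∸ suc B ≤? i) (suc i ≤? m) (i + 2 ≤? α)
                                {x = S (suc m ∸ B) (m ∸ B) α i q p} {y = 0#}
                          (s≤s 1≤B , subst (_≤ i) (≡.sym [m+1]∸[1+B]≡m∸B) m∸B≤i , i<m , i+2≤α))))) ⟩
              rhs-row i ∎
              where
              i<m : i < m
              i<m = ≤pred⇒< 1≤m i≤m∸1

          SPart-sum : ∑³[ SPart ] ≈ rhs S (suc m ∸ B) (m ∸ B) q e
          SPart-sum = begin
            ∑[ 0 ⋯ m ] row
              ≈⟨ ∑[⋯]-dropˡ 0 (m ∸ B) m row z≤n (ℕₚ.≤-trans (ℕₚ.m∸n≤m m B) (ℕₚ.n≤1+n m))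
                   (λ i _ i<m∸B → ∑[⋯]-zero 1 (suc m) (λ α _ → ∑-zero (k α) (λ p →
                      SPart-off i α p (λ (_ , m∸B≤i , _) →
                        ℕₚ.<⇒≱ i<m∸B (subst (_≤ i) [m+1]∸[1+B]≡m∸B m∸B≤i))))) ⟩
            ∑[ m ∸ B ⋯ m ] row
              ≈⟨ ∑[⋯]-dropʳ (m ∸ B) (m ∸ 1) m row
                   (ℕₚ.≤-trans (ℕₚ.m∸n≤m m B) (ℕₚ.m≤n+m∸n m 1)) (ℕₚ.m∸n≤m m 1)
                   (λ i m∸1<i _ → ∑[⋯]-zero 1 (suc m) (λ α _ → ∑-zero (k α) (λ p →
                      SPart-off i α p (λ (_ , _ , i<m , _) → ℕₚ.<⇒≱ m∸1<i (<⇒≤pred i<m))))) ⟩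
            ∑[ m ∸ B ⋯ m ∸ 1 ] row
              ≈⟨ ∑[⋯]-cong (m ∸ B) (m ∸ 1) row≈rhs-row ⟩
            rhs S (suc m ∸ B) (m ∸ B) q e ∎

    C-column-relation : ∀ B → B ≤ m → ∀ q e → ColumnRelation B q e ≈ 0#
    C-column-relation zero B≤m q e = begin
      ColumnRelation 0 q e                 ≈⟨ relation-split ⟩
      ∑³[ identityPart ] +ᴷ ∑³[ SPart ]    ≈⟨ +-cong identity-sum (SPart-sum-col0 ≡.refl) ⟩
      (N ^ m · l (suc m) q) e +ᴷ 0#         ≈⟨ +-identityʳ _ ⟩
      (N ^ m · l (suc m) q) e               ≈⟨ nilpotent⇒^·≈0 {m} nilpotent ℕₚ.≤-refl (l (suc m) q) e ⟩
      0#                                    ∎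
      where open ColumnParts B≤m q e
    C-column-relation (suc B₀) B<m q e = begin
      ColumnRelation (suc B₀) q e                              ≈⟨ relation-split ⟩
      ∑³[ identityPart ] +ᴷ ∑³[ SPart ]                         ≈⟨ +-cong identity-sum (SPart-sum (s≤s z≤n)) ⟩
      (N ^ (m ∸ suc B₀) · l u q) e +ᴷ rhs S u (m ∸ suc B₀) q e   ≈⟨ +-congʳ S-equation ⟩
      - rhs S u (m ∸ suc B₀) q e +ᴷ rhs S u (m ∸ suc B₀) q e     ≈⟨ -‿inverseˡ _ ⟩
      0#                                                       ∎
      where
      open ColumnParts B<m q e
      u : ℕ
      u = m ∸ B₀
      u∸1≡m∸[1+B₀] : u ∸ 1 ≡ m ∸ suc B₀
      u∸1≡m∸[1+B₀] = ≡.trans (ℕₚ.∸-+-assoc m B₀ 1) (cong (m ∸_) (ℕₚ.+-comm B₀ 1))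
      S-equation : (N ^ (m ∸ suc B₀) · l u q) e ≈ - rhs S u (m ∸ suc B₀) q e
      S-equation = subst (λ v → (N ^ v · l u q) e ≈ - rhs S u v q e) u∸1≡m∸[1+B₀]
                         (seq u (ℕₚ.m<n⇒0<n∸m B<m) (ℕₚ.m∸n≤m m B₀) q e)

  module _ (spans : Spans 0) (independent : Independent 0) (peq : PEq P) where
    open Coordinates F N m k l spans independent

    diagonalCoord : Vector d → (B : ℕ) → Fin (k (suc m ∸ B)) → Carrier
    diagonalCoord x B q = coord x (m ∸ suc B) (suc m ∸ B) q

    diagonal-basisIndex : ∀ {B} → B < m → BasisIndex (m ∸ suc B) (suc m ∸ B)
    diagonal-basisIndex {B} B<m =
      (z≤n , ℕₚ.∸-monoʳ-≤ m (s≤s z≤n)) , (ℕₚ.≤-reflexive (m∸[1+n]+2≡1+m∸n B<m) , ℕₚ.m∸n≤m (suc m) B)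

    private
      m∸[1+j]<m : ∀ {j} → j < m → m ∸ suc j < m
      m∸[1+j]<m j<m = ℕₚ.∸-monoʳ-< (s≤s z≤n) j<m

    module _ {j α B : ℕ} (p : Fin (k α)) (q : Fin (k (suc m ∸ B)))
             (j<m : j < m) (B<m : B < m) (1≤α : 1 ≤ α) (α≤1+m : α ≤ suc m) where

      private
        goal : Set ℓ
        goal = C̄-entry j α p B q ≈ diagonalCoord (N ^ (m ∸ suc j) · l α p) B q

        C̄-column-P-rows : α ≤ m ∸ j → goal
        C̄-column-P-rows α≤m∸j = case B ≤? j of λ where
          (yes B≤j) →
            trans (reflexive (C̄-entry-P 1≤α j<m α≤m∸j B≤j))
                  (sym (coord-PEq P peq 1≤α α≤1+m (m∸[1+j]<m j<m) p (diagonal-basisIndex B<m)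
                         (ℕₚ.∸-monoʳ-≤ m (s≤s B≤j)) q))
          (no B≰j) →
            trans (reflexive (C̄-entry-0 (λ (_ , _ , B≡j) → B≰j (ℕₚ.≤-reflexive B≡j))
                                        (λ (_ , _ , B<1+j) → B≰j (ℕₚ.≤-pred B<1+j))))
                  (sym (coord-PEq-below P peq 1≤α α≤1+m (m∸[1+j]<m j<m) p (diagonal-basisIndex B<m)
                         (ℕₚ.∸-monoʳ-< (s≤s (ℕₚ.≰⇒> B≰j)) B<m) q))

        α≡ : j ≤ m → pred α ≡ m ∸ j → α ≡ suc m ∸ j
        α≡ j≤m pα≡ = ≡.trans (pred≡⇒≡suc 1≤α pα≡) (≡.sym (1+m∸n≡1+[m∸n] j≤m))

        basisIndex-below : ¬ α ≤ m ∸ j → BasisIndex (m ∸ suc j) α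
        basisIndex-below α≰m∸j =
          (z≤n , ℕₚ.∸-monoʳ-≤ m (s≤s z≤n))
          , (ℕₚ.≤-trans (ℕₚ.≤-reflexive (≡.trans (m∸[1+n]+2≡1+m∸n j<m) (1+m∸n≡1+[m∸n] (ℕₚ.<⇒≤ j<m))))
                        (ℕₚ.≰⇒> α≰m∸j)
            , α≤1+m)

        off-diagonal : ¬ (B ≡ j × α ≡ suc m ∸ j) → ¬ (m ∸ suc B ≡ m ∸ suc j × suc m ∸ B ≡ α)
        off-diagonal ¬diagonal (z≡v , y≡α) =
          ¬diagonal (B≡j , ≡.trans (≡.sym y≡α) (cong (suc m ∸_) B≡j))
          where
          B≡j : B ≡ j
          B≡j = ℕₚ.suc-injective (ℕₚ.∸-cancelˡ-≡ B<m j<m z≡v)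

        C̄-column-basis-rows : ¬ α ≤ m ∸ j → goal
        C̄-column-basis-rows α≰m∸j = case (B ≟ j) ×-dec (α ≟ suc m ∸ j) of λ where
          (yes (≡.refl , ≡.refl)) →
            trans (reflexive (≡.trans (C̄-entry-identity (ℕₚ.<⇒≤ j<m) (1+m∸n≡1+[m∸n] (ℕₚ.<⇒≤ j<m)) ≡.refl)
                                      (δ-sym (toℕ p) (toℕ q))))
                  (sym (coord-basisVector-self (diagonal-basisIndex j<m) p q))
          (no ¬diagonal) →
            trans (reflexive (C̄-entry-0 (λ (j≤m , pα≡ , B≡j) → ¬diagonal (B≡j , α≡ j≤m pα≡))
                                        (λ (_ , α≤m∸j , _) → α≰m∸j α≤m∸j)))
                  (sym (coord-basisVector-other (basisIndex-below α≰m∸j) p (diagonal-basisIndex B<m)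
                                                (off-diagonal ¬diagonal) q))

      C̄-column≈diagonalCoord : C̄-entry j α p B q ≈ diagonalCoord (N ^ (m ∸ suc j) · l α p) B q
      C̄-column≈diagonalCoord = case α ≤? m ∸ j of λ where
        (yes α≤m∸j) → C̄-column-P-rows α≤m∸j
        (no α≰m∸j)  → C̄-column-basis-rows α≰m∸j

    module _ (nilpotent : NilpotentOfOrder N m) (seq : SEq S) where
      open MatrixPowers F N using (^·-+; ^·-zero; nilpotent⇒^·≈0; module Linear^·)

      private
        module BelowDiagonal {n B : ℕ} (q : Fin (k (suc m ∸ B))) {B′} (q′ : Fin (k (suc m ∸ B′)))
                             (n<m : n < m) (B≤m : B ≤ m) (B′<m : B′ < m) where

          open LinearCoord (diagonal-basisIndex B′<m) q′ renaming (Φ-∑³ to coord-∑³; Φ-0 to coord-0)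

          s : ℕ
          s = m ∸ suc n

          Cᵇ : (i α : ℕ) → Fin (k α) → Carrier
          Cᵇ i α p = C-entry i α p B q

          shifted : (i α : ℕ) → Fin (k α) → Vector d
          shifted i α p = N ^ s · (N ^ i · l α p)

          term : (i α : ℕ) → Fin (k α) → Carrier
          term i α p = Cᵇ i α p *ᴷ diagonalCoord (shifted i α p) B′ q′

          C̄≈coord-shifted : ∀ i α p → Within k 0 n (λ _ → 1) (λ _ → suc m) i α →
                            productTerm n B q B′ q′ i α p ≈ term i α p
          C̄≈coord-shifted i α p ((_ , i≤n) , (1≤α , α≤1+m)) = *-congˡ (trans
            (C̄-column≈diagonalCoord p q′ (ℕₚ.≤-<-trans (ℕₚ.m∸n≤m n i) n<m) B′<m 1≤α α≤1+m)
            (coord-cong (diagonal-basisIndex B′<m) q′ (λ e →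
              trans (reflexive (cong (λ t → (N ^ t · l α p) e) (m∸[1+[n∸i]]≡m∸[1+n]+i i≤n n<m)))
                    (^·-+ s i (l α p) e))))

          tail-vanishes : ∀ i → n < i → i ≤ m → ∑[ 1 ⋯ suc m ] (λ α → ∑ (k α) (term i α)) ≈ 0#
          tail-vanishes i n<i _ = ∑[⋯]-zero 1 (suc m) (λ α _ → ∑-zero (k α) (λ p →
            trans (*-congˡ {Cᵇ i α p} (trans (coord-cong (diagonal-basisIndex B′<m) q′ (λ e →
                                     trans (sym (^·-+ s i (l α p) e))
                                           (nilpotent⇒^·≈0 nilpotent m≤s+i (l α p) e)))
                                  coord-0))
                  (zeroʳ (Cᵇ i α p))))
            where
            m≤s+i : m ≤ s + i
            m≤s+i = ℕₚ.≤-trans (ℕₚ.≤-reflexive (≡.sym (ℕₚ.m∸n+n≡m n<m))) (ℕₚ.+-monoʳ-≤ s n<i)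

          -- The sum is a diagonal coordinate of Nˢ applied to a column relation of B(S).
          productSum≈0 : productSum n B q B′ q′ ≈ 0#
          productSum≈0 = begin
            productSum n B q B′ q′
              ≈⟨ ∑³-cong k 0 n (λ _ → 1) (λ _ → suc m) C̄≈coord-shifted ⟩
            ∑³ k 0 n (λ _ → 1) (λ _ → suc m) term
              ≈⟨ ∑[⋯]-dropʳ 0 n m _ z≤n (ℕₚ.<⇒≤ n<m) tail-vanishes ⟨
            ∑³ k 0 m (λ _ → 1) (λ _ → suc m) term
              ≈⟨ coord-∑³ k 0 m (λ _ → 1) (λ _ → suc m) Cᵇ shifted ⟨
            diagonalCoord (λ e → ∑³ k 0 m (λ _ → 1) (λ _ → suc m) (λ i α p → Cᵇ i α p *ᴷ shifted i α p e))
                          B′ q′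
              ≈⟨ coord-cong (diagonal-basisIndex B′<m) q′ (λ e →
                   Linear^·.Φ-∑³ s e k 0 m (λ _ → 1) (λ _ → suc m) Cᵇ (λ i α p → N ^ i · l α p)) ⟨
            diagonalCoord (N ^ s · ColumnRelation nilpotent seq B q) B′ q′
              ≈⟨ coord-cong (diagonal-basisIndex B′<m) q′
                   (^·-zero s (C-column-relation nilpotent seq B B≤m q)) ⟩
            diagonalCoord (λ _ → 0#) B′ q′
              ≈⟨ coord-0 ⟩
            0# ∎

      productSum-below : ∀ {n B} (q : Fin (k (suc m ∸ B))) {B′} (q′ : Fin (k (suc m ∸ B′))) →
                         n < m → B ≤ m → productSum n B q B′ q′ ≈ 0#
      productSum-below {n} {B} q {B′} q′ n<m B≤m = case B′ <? m of λ where
        (yes B′<m) → BelowDiagonal.productSum≈0 q q′ n<m B≤m B′<m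
        (no B′≮m)  → ∑³-zero k 0 n (λ _ → 1) (λ _ → suc m) (productTerm n B q B′ q′)
                                     (λ i α p ((_ , i≤n) , _) →
          trans (*-congˡ (reflexive (C̄-entry-lastColumn (ℕₚ.≤-<-trans (ℕₚ.m∸n≤m n i) n<m) (ℕₚ.≮⇒≥ B′≮m))))
                (zeroʳ _))

lemma3p32 : ∀ {c ℓ} (F : Field c ℓ) (d : ℕ) (N : LinAlg.Mat F d d) (m : ℕ)
    (k : ℕ → ℕ) (l : (u : ℕ) → Fin (k u) → LinAlg.Vector F d) →
    1 ≤ m →
    LinAlg.NilpotentOfOrder F N m →
    Setting.BasisHyp F N m k l →
    (S : Setting.Fam F N m k l) → Setting.SEq F N m k l S →
    (P : Setting.Fam F N m k l) → Setting.PEq F N m k l P →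
    Setting.ProductIdentity F N m k l S P
lemma3p32 F d N m k l 1≤m nilpotent basis S seq P peq n (b , q) (b′ , q′) =
  trans (reflexive (productCoeff≡productSum n b q b′ q′)) (by-order (ℕₚ.<-cmp n m))
  where
  open Field F
  open Setting F N m k l
  open Blocks F N m k l S P
  spans : Spans 0
  spans = proj₁ (basis 0 1≤m)
  independent : Independent 0
  independent = proj₂ (basis 0 1≤m)
  by-order : Tri (n < m) (n ≡ m) (m < n) →
             productSum n (toℕ b) q (toℕ b′) q′ ≈ targetCoeff n (b , q) (b′ , q′)
  by-order (tri< n<m _ _) =
    trans (productSum-below spans independent peq nilpotent seq q q′ n<m (ℕₚ.≤-pred (Finₚ.toℕ<n b)))
          (reflexive (≡.sym (if-no (n ≟ m) (ℕₚ.<⇒≢ n<m))))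
  by-order (tri> _ _ m<n) =
    trans (productSum-above q q′ m<n) (reflexive (≡.sym (if-no (n ≟ m) (ℕₚ.<⇒≢ m<n ∘ ≡.sym))))
  by-order (tri≈ _ ≡.refl _) =
    trans (productSum-m≈I b q b′ q′) (reflexive (≡.sym (if-yes (m ≟ m) ≡.refl)))
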